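{- Let $n,m\ge0$ be coprime integers and let $Z=\bigoplus_{j\in\mathbb Z}Z^j$ be a graded $1$-truncated Dieudonn\'e module of type $(n,m)$. Then there exists an integer $c$ such that $\dim_kZ=c(n+m)$ and such that for every $j\in\mathbb Z$ one has $\sum_{i\equiv j\ (\mathrm{mod}\ n+m)}\dim_kZ^i=c$.
   Context: $k$ is an algebraically closed field of characteristic $p>0$. A $1$-truncated Dieudonn\'e module is a finite-dimensional $k$-vector space $Z$ with an endomorphism $F$ that is linear with respect to $a\mapsto a^p$ and an endomorphism $V$ linear with respect to $a\mapsto a^{1/p}$ such that $\ker F=\operatorname{Im}V$ and $\operatorname{Im}F=\ker V$. A graded $1$-truncated Dieudonn\'e module of type $(n,m)$ is a $1$-truncated Dieudonn\'e module with a $\mathbb Z$-grading $Z=\bigoplus_jZ^j$ such that $F(Z^j)\subseteq Z^{j+n}$ and $V(Z^j)\subseteq Z^{j+m}$ for all $j$. -}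

module Defs where

open import Level using (_⊔_) renaming (suc to lsuc)
open import Algebra.Bundles using (CommutativeRing)
open import Data.Nat as ℕ using (ℕ; zero; suc)
open import Data.Nat.Primality using (Prime)
open import Data.Nat.Divisibility using (_∣?_)
open import Data.Integer as ℤ using (ℤ; +_; ∣_∣)
open import Data.Fin using (Fin)
open import Data.List using (List; []; _∷_; map; upTo; filter)
open import Data.Nat.ListAction using (sum)
open import Data.Product using (Σ; ∃; ∃-syntax; _×_; _,_)
open import Relation.Nullary using (¬_)
open import Relation.Binary.PropositionalEquality using (_≡_; _≢_)
open import Function.Bundles using (_⇔_)

module _ {c ℓ} (K : CommutativeRing c ℓ) where
  open CommutativeRing K renaming (Carrier to A)

  pow : A → ℕ → A
  pow a zero    = 1#
  pow a (suc k) = a * pow a k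

  natOne : ℕ → A
  natOne zero    = 0#
  natOne (suc k) = 1# + natOne k

  IsField : Set (c ⊔ ℓ)
  IsField = (¬ (1# ≈ 0#)) × (∀ a → ¬ (a ≈ 0#) → ∃[ b ] (a * b ≈ 1#))

  -- evaluation of the monic polynomial X^d + a_{d-1} X^{d-1} + ... + a_0,
  -- where the list is (a_0 ∷ a_1 ∷ ... ∷ a_{d-1}) and d is its length
  evalMonic : List A → A → A
  evalMonic []       x = 1#
  evalMonic (a ∷ as) x = a + x * evalMonic as x

  IsAlgClosedField : Set (c ⊔ ℓ)
  IsAlgClosedField = IsField × (∀ a as → ∃[ x ] (evalMonic (a ∷ as) x ≈ 0#))

  HasCharacteristic : ℕ → Set ℓ
  HasCharacteristic p = Prime p × (natOne p ≈ 0#)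

  -- Coordinate model of a ℤ-graded finite-dimensional k-vector space:
  -- Z^j = k^(d j), Z = ⊕_j Z^j, with d finitely supported.
  Elem : (ℤ → ℕ) → Set c
  Elem d = (j : ℤ) → Fin (d j) → A

  module _ (d : ℤ → ℕ) where
    _≈ᴱ_ : Elem d → Elem d → Set ℓ
    x ≈ᴱ y = ∀ j t → x j t ≈ y j t

    0ᴱ : Elem d
    0ᴱ j t = 0#

    _+ᴱ_ : Elem d → Elem d → Elem d
    (x +ᴱ y) j t = x j t + y j t

    _·ᴱ_ : A → Elem d → Elem d
    (a ·ᴱ x) j t = a * x j t

    Homog : ℤ → Elem d → Set ℓ
    Homog j x = ∀ i → i ≢ j → ∀ t → x i t ≈ 0#

  record GradedDieudonne1 (p n m : ℕ) : Set (c ⊔ ℓ) where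
    field
      d        : ℤ → ℕ
      bound    : ℕ
      support  : ∀ j → bound ℕ.< ∣ j ∣ → d j ≡ 0
      F        : Elem d → Elem d
      V        : Elem d → Elem d
      F-cong   : ∀ x y → _≈ᴱ_ d x y → _≈ᴱ_ d (F x) (F y)
      V-cong   : ∀ x y → _≈ᴱ_ d x y → _≈ᴱ_ d (V x) (V y)
      F-add    : ∀ x y → _≈ᴱ_ d (F (_+ᴱ_ d x y)) (_+ᴱ_ d (F x) (F y))
      V-add    : ∀ x y → _≈ᴱ_ d (V (_+ᴱ_ d x y)) (_+ᴱ_ d (V x) (V y))
      F-semi   : ∀ a x → _≈ᴱ_ d (F (_·ᴱ_ d a x)) (_·ᴱ_ d (pow a p) (F x))
      -- V is linear w.r.t. a ↦ a^(1/p), i.e. V(b^p x) = b V(x)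
      V-semi   : ∀ b x → _≈ᴱ_ d (V (_·ᴱ_ d (pow b p) x)) (_·ᴱ_ d b (V x))
      kerF=imV : ∀ x → (_≈ᴱ_ d (F x) (0ᴱ d)) ⇔ (∃[ y ] _≈ᴱ_ d (V y) x)
      imF=kerV : ∀ x → (∃[ y ] _≈ᴱ_ d (F y) x) ⇔ (_≈ᴱ_ d (V x) (0ᴱ d))
      F-graded : ∀ j x → Homog d j x → Homog d (j ℤ.+ + n) (F x)
      V-graded : ∀ j x → Homog d j x → Homog d (j ℤ.+ + m) (V x)

    degrees : List ℤ
    degrees = map (λ t → + t ℤ.- + bound) (upTo (suc (bound ℕ.+ bound)))

    dim : ℕ
    dim = sum (map d degrees)

    classDim : ℕ → ℤ → ℕ
    classDim q j = sum (map d (filter (λ i → q ∣? ∣ i ℤ.- j ∣) degrees))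

-- Over an algebraically closed field x ↦ x ^ p is bijective, so the graded pieces
-- F : Z^j → Z^(j+n) and V : Z^j → Z^(j+m) are semilinear maps with ranks a_j and b_j, and
-- exactness (ker F = im V, ker V = im F) gives dim Z^j = b_(j-m) + a_j = a_(j-n) + b_j.
-- Summing the first identity over the residue class of j and the second over the class of
-- j + n modulo q = n + m produces the same terms (since m ≡ -n), so the class sums are
-- invariant under j ↦ j + n as well as q-periodic; as gcd (n, q) = 1 they are constant, and
-- dim Z is q times that constant.  Equality of scalars is not decidable, so the linear
-- algebra runs in the double-negation monad; the conclusions are equalities of natural
-- numbers, hence stable.

{-# OPTIONS --safe #-}
module Submission where

open import Defs
open import Algebra.Bundles using (CommutativeRing)
open import Data.Nat as ℕ using (ℕ)
open import Data.Nat.Coprimality using (Coprime)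
open import Data.Integer as ℤ using (ℤ; +_)
open import Data.Product using (∃-syntax; _×_)
open import Relation.Binary.PropositionalEquality using (_≡_)
open import Data.Product using (_,_)
open import Data.Nat.Primality using (prime⇒nonZero)
open import Data.Integer.Properties using (pos-*)
open import Relation.Nullary.Decidable using (decidable-stable)
import Relation.Binary.PropositionalEquality as ≡

module Classical where

  open import Level using (Level)
  open import Function using (_∘_)
  open import Data.Fin using (Fin; zero; suc)
  open import Data.List using (List; []; _∷_)
  open import Data.List.Membership.Propositional using (_∈_)
  open import Data.List.Relation.Unary.Any using (here; there)
  open import Data.Product using (Σ; _,_)
  open import Data.Sum using (_⊎_; inj₁; inj₂)
  open import Relation.Nullary using (¬_; yes; no)
  open import Relation.Nullary.Negation using (contradiction)
  open import Relation.Nullary.Decidable using (¬¬-excluded-middle)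
  open import Relation.Binary.PropositionalEquality using (refl)

  private variable
    a b : Level
    X : Set a
    Y : Set b

  infixl 1 _>>=_

  _>>=_ : ¬ ¬ X → (X → ¬ ¬ Y) → ¬ ¬ Y
  (m >>= f) k = m (λ x → f x k)

  pure : X → ¬ ¬ X
  pure = contradiction

  ¬¬-∀Fin : ∀ {k} {P : Fin k → Set a} → (∀ i → ¬ ¬ P i) → ¬ ¬ (∀ i → P i)
  ¬¬-∀Fin {k = ℕ.zero} f = pure λ ()
  ¬¬-∀Fin {k = ℕ.suc k} f = do
    p₀ ← f zero
    ps ← ¬¬-∀Fin (f ∘ suc)
    pure λ { zero → p₀ ; (suc i) → ps i }

  ¬¬-∀∈ : {P : X → Set b} → (∀ x → ¬ ¬ P x) → ∀ xs → ¬ ¬ (∀ x → x ∈ xs → P x)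
  ¬¬-∀∈ f [] = pure λ _ ()
  ¬¬-∀∈ f (x ∷ xs) = do
    p  ← f x
    ps ← ¬¬-∀∈ f xs
    pure λ { _ (here refl) → p ; y (there y∈xs) → ps y y∈xs }

  ¬¬-all-or-counterexample : ∀ {k} (P : Fin k → Set a) → ¬ ¬ ((∀ i → P i) ⊎ Σ (Fin k) (¬_ ∘ P))
  ¬¬-all-or-counterexample {k = ℕ.zero} P = pure (inj₁ λ ())
  ¬¬-all-or-counterexample {k = ℕ.suc k} P = ¬¬-excluded-middle >>= λ where
    (no ¬p₀) → pure (inj₂ (zero , ¬p₀))
    (yes p₀) → ¬¬-all-or-counterexample (P ∘ suc) >>= λ where
      (inj₁ ps)       → pure (inj₁ λ { zero → p₀ ; (suc i) → ps i })
      (inj₂ (i , ¬p)) → pure (inj₂ (suc i , ¬p))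

module LinearAlgebra {c ℓ} (K : CommutativeRing c ℓ) (isField : IsField K) where

  open import Level using (_⊔_) renaming (suc to lsuc)
  open import Function using (_∘_)
  open import Data.Nat using (zero; suc; _≤_; z≤n; s≤s)
  open import Data.Nat.Properties using (m≤n⇒m≤1+n; ≤-antisym)
  open import Data.Fin using (Fin; zero; suc; punchIn; _↑ˡ_; _↑ʳ_)
  open import Data.Fin.Properties using (_≟_)
  open import Data.Vec.Functional using (Vector; _∷_; _++_; insertAt)
  open import Data.Vec.Functional.Properties using (insertAt-lookup; insertAt-punchIn; lookup-++ˡ; lookup-++ʳ)
  open import Data.Bool using (if_then_else_)
  open import Data.Product using (Σ; Σ-syntax; ∃; _×_; _,_; proj₁; proj₂)
  open import Data.Sum using (inj₁; inj₂)
  open import Relation.Nullary using (¬_; does; yes; no; contradiction)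
  open import Relation.Nullary.Decidable using (¬¬-excluded-middle; decidable-stable)
  open import Relation.Binary.PropositionalEquality as ≡ using (_≡_)
  open CommutativeRing K renaming (Carrier to A) hiding (zero)
  open import Algebra.Properties.Semiring.Sum semiring
    using (sum; sum-cong-≋; sum-replicate-zero; ∑-distrib-+; ∑-comm; *-distribˡ-sum; *-distribʳ-sum; sum-remove)
  open import Algebra.Properties.Ring ring using (-1*x≈-x; -‿distribˡ-*; -‿distribʳ-*; +-inverseˡ-unique; x[y-z]≈xy-xz; x+x≈x⇒x≈0)
  open import Relation.Binary.Reasoning.Setoid setoid
  open Classical

  1≉0 : ¬ 1# ≈ 0#
  1≉0 = proj₁ isField

  inverse : ∀ a → ¬ a ≈ 0# → ∃ λ b → a * b ≈ 1#
  inverse = proj₂ isField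

  infix 4 _≋_
  _≋_ : ∀ {n} → Vector A n → Vector A n → Set ℓ
  u ≋ v = ∀ t → u t ≈ v t

  0v : ∀ {n} → Vector A n
  0v _ = 0#

  linComb : ∀ {k n} → (Fin k → Vector A n) → Vector A k → Vector A n
  linComb u α t = sum λ i → α i * u i t

  InSpan : ∀ {k n} → (Fin k → Vector A n) → Vector A n → Set (c ⊔ ℓ)
  InSpan {k} u x = Σ[ β ∈ Vector A k ] x ≋ linComb u β

  Independent : ∀ {k n} → (Fin k → Vector A n) → Set (c ⊔ ℓ)
  Independent u = ∀ α → linComb u α ≋ 0v → ∀ i → ¬ ¬ α i ≈ 0#

  sum-zero : ∀ {k} {f : Vector A k} → (∀ i → f i ≈ 0#) → sum f ≈ 0#
  sum-zero {k} h = trans (sum-cong-≋ h) (sum-replicate-zero k)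

  sum-neg : ∀ {k} (f : Vector A k) → sum (λ i → - f i) ≈ - sum f
  sum-neg f = begin
    sum (λ i → - f i)        ≈⟨ sum-cong-≋ (λ i → -1*x≈-x (f i)) ⟨
    sum (λ i → - 1# * f i)   ≈⟨ *-distribˡ-sum (- 1#) f ⟨
    - 1# * sum f             ≈⟨ -1*x≈-x _ ⟩
    - sum f                  ∎

  module _ {k n} (u : Fin k → Vector A n) where

    linComb-cong : ∀ {α β} → (∀ i → α i ≈ β i) → linComb u α ≋ linComb u β
    linComb-cong h t = sum-cong-≋ {k} λ i → *-congʳ (h i)

    linComb-+ : ∀ α β t → linComb u (λ i → α i + β i) t ≈ linComb u α t + linComb u β t
    linComb-+ α β t = trans (sum-cong-≋ {k} λ i → distribʳ (u i t) (α i) (β i)) (∑-distrib-+ (λ i → α i * u i t) (λ i → β i * u i t))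

    linComb-* : ∀ a α t → linComb u (λ i → a * α i) t ≈ a * linComb u α t
    linComb-* a α t = begin
      sum (λ i → (a * α i) * u i t)   ≈⟨ sum-cong-≋ {k} (λ i → *-assoc a (α i) (u i t)) ⟩
      sum (λ i → a * (α i * u i t))   ≈⟨ *-distribˡ-sum a (λ i → α i * u i t) ⟨
      a * linComb u α t               ∎

    linComb-neg : ∀ α t → linComb u (λ i → - α i) t ≈ - linComb u α t
    linComb-neg α t = begin
      sum (λ i → - α i * u i t)    ≈⟨ sum-cong-≋ {k} (λ i → -‿distribˡ-* (α i) (u i t)) ⟨
      sum (λ i → - (α i * u i t))  ≈⟨ sum-neg (λ i → α i * u i t) ⟩
      - linComb u α t              ∎

    linComb-sub : ∀ α β a t → linComb u (λ i → α i - a * β i) t ≈ linComb u α t - a * linComb u β t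
    linComb-sub α β a t = begin
      linComb u (λ i → α i - a * β i) t               ≈⟨ linComb-+ α (λ i → - (a * β i)) t ⟩
      linComb u α t + linComb u (λ i → - (a * β i)) t ≈⟨ +-congˡ (linComb-neg (λ i → a * β i) t) ⟩
      linComb u α t - linComb u (λ i → a * β i) t     ≈⟨ +-congˡ (-‿cong (linComb-* a β t)) ⟩
      linComb u α t - a * linComb u β t               ∎

    linComb-shear : ∀ (e : Vector A k) (x : Vector A n) (α : Vector A k) t →
                    linComb (λ i t → u i t - e i * x t) α t ≈ linComb u α t - sum (λ i → α i * e i) * x t
    linComb-shear e x α t = begin
      sum (λ i → α i * (u i t - e i * x t))                      ≈⟨ sum-cong-≋ {k} (λ i → x[y-z]≈xy-xz (α i) (u i t) (e i * x t)) ⟩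
      sum (λ i → α i * u i t + - (α i * (e i * x t)))            ≈⟨ ∑-distrib-+ (λ i → α i * u i t) (λ i → - (α i * (e i * x t))) ⟩
      linComb u α t + sum (λ i → - (α i * (e i * x t)))          ≈⟨ +-congˡ (sum-neg (λ i → α i * (e i * x t))) ⟩
      linComb u α t - sum (λ i → α i * (e i * x t))              ≈⟨ +-congˡ (-‿cong (sum-cong-≋ {k} λ i → sym (*-assoc (α i) (e i) (x t)))) ⟩
      linComb u α t - sum (λ i → (α i * e i) * x t)              ≈⟨ +-congˡ (-‿cong (*-distribʳ-sum (x t) (λ i → α i * e i))) ⟨
      linComb u α t - sum (λ i → α i * e i) * x t                ∎

  linComb-headless : ∀ {k n} (u : Fin (suc k) → Vector A n) α → α zero ≈ 0# →
                     linComb u α ≋ linComb (u ∘ suc) (α ∘ suc)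
  linComb-headless u α α₀≈0 t = begin
    α zero * u zero t + linComb (u ∘ suc) (α ∘ suc) t  ≈⟨ +-congʳ (trans (*-congʳ α₀≈0) (zeroˡ _)) ⟩
    0# + linComb (u ∘ suc) (α ∘ suc) t                 ≈⟨ +-identityˡ _ ⟩
    linComb (u ∘ suc) (α ∘ suc) t                      ∎

  linComb-insertAt : ∀ {k n} (u : Fin (suc k) → Vector A n) α i a t →
                     linComb u (insertAt α i a) t ≈ a * u i t + linComb (u ∘ punchIn i) α t
  linComb-insertAt u α i a t = begin
    linComb u (insertAt α i a) t
      ≈⟨ sum-remove {i = i} (λ j → insertAt α i a j * u j t) ⟩
    insertAt α i a i * u i t + sum (λ j → insertAt α i a (punchIn i j) * u (punchIn i j) t)
      ≈⟨ +-cong (*-congʳ (reflexive (insertAt-lookup α i a)))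
                (sum-cong-≋ λ j → *-congʳ (reflexive (insertAt-punchIn α i a j))) ⟩
    a * u i t + linComb (u ∘ punchIn i) α t ∎

  linComb-linComb : ∀ {k s n} (u : Fin k → Vector A n) (w : Fin s → Vector A n) (β : Fin k → Vector A s) →
                    (∀ i → u i ≋ linComb w (β i)) → ∀ α → linComb u α ≋ linComb w (λ j → sum λ i → α i * β i j)
  linComb-linComb {k} {s} u w β u≋ α t = begin
    sum (λ i → α i * u i t)                              ≈⟨ sum-cong-≋ {k} (λ i → *-congˡ (u≋ i t)) ⟩
    sum (λ i → α i * sum (λ j → β i j * w j t))          ≈⟨ sum-cong-≋ {k} (λ i → *-distribˡ-sum (α i) (λ j → β i j * w j t)) ⟩
    sum (λ i → sum (λ j → α i * (β i j * w j t)))        ≈⟨ ∑-comm (λ i j → α i * (β i j * w j t)) ⟩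
    sum (λ j → sum (λ i → α i * (β i j * w j t)))        ≈⟨ sum-cong-≋ {s} (λ j → sum-cong-≋ {k} λ i → sym (*-assoc _ _ _)) ⟩
    sum (λ j → sum (λ i → (α i * β i j) * w j t))        ≈⟨ sum-cong-≋ {s} (λ j → *-distribʳ-sum (w j t) (λ i → α i * β i j)) ⟨
    sum (λ j → sum (λ i → α i * β i j) * w j t)          ∎

  basis : ∀ {n} → Fin n → Vector A n
  basis i t = if does (i ≟ t) then 1# else 0#

  linComb-basis : ∀ {n} (v : Vector A n) → linComb basis v ≋ v
  linComb-basis {suc n} v zero = begin
    v zero * 1# + sum (λ i → v (suc i) * 0#)  ≈⟨ +-cong (*-identityʳ _) (sum-zero {n} λ _ → zeroʳ _) ⟩
    v zero + 0#                               ≈⟨ +-identityʳ _ ⟩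
    v zero                                    ∎
  linComb-basis {suc n} v (suc t) = begin
    v zero * 0# + linComb basis (v ∘ suc) t   ≈⟨ +-cong (zeroʳ _) (linComb-basis (v ∘ suc) t) ⟩
    0# + v (suc t)                            ≈⟨ +-identityˡ _ ⟩
    v (suc t)                                 ∎

  basis-spans : ∀ {n} (v : Vector A n) → InSpan basis v
  basis-spans v = v , λ t → sym (linComb-basis v t)

  basis-independent : ∀ {n} → Independent (basis {n})
  basis-independent α h i = pure (trans (sym (linComb-basis α i)) (h i))

  -- Subtracting multiples of the pivot u i₀ clears the coefficient of w zero in the other u i.
  module Exchange {N s k} (w : Fin (suc s) → Vector A N) (u : Fin (suc k) → Vector A N)
                  (u-independent : Independent u)
                  (coeff : Fin (suc k) → Vector A (suc s)) (u≋ : ∀ i → u i ≋ linComb w (coeff i))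
                  (i₀ : Fin (suc k)) (pivot≉0 : ¬ coeff i₀ zero ≈ 0#) where

    γ : A
    γ = proj₁ (inverse _ pivot≉0)

    e : Fin k → A
    e i = coeff (punchIn i₀ i) zero * γ

    u′ : Fin k → Vector A N
    u′ i t = u (punchIn i₀ i) t - e i * u i₀ t

    u′-inSpan : ∀ i → InSpan (w ∘ suc) (u′ i)
    u′-inSpan i = η ∘ suc , λ t → begin
        u′ i t                                               ≈⟨ +-cong (u≋ p t) (-‿cong (*-congˡ (u≋ i₀ t))) ⟩
        linComb w (coeff p) t - e i * linComb w (coeff i₀) t ≈⟨ linComb-sub w (coeff p) (coeff i₀) (e i) t ⟨
        linComb w η t                                        ≈⟨ linComb-headless w η η₀≈0 t ⟩
        linComb (w ∘ suc) (η ∘ suc) t                        ∎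
      where
      p = punchIn i₀ i
      η : Vector A (suc s)
      η j = coeff p j - e i * coeff i₀ j
      η₀≈0 : η zero ≈ 0#
      η₀≈0 = begin
        coeff p zero - coeff p zero * γ * coeff i₀ zero    ≈⟨ +-congˡ (-‿cong (*-assoc _ _ _)) ⟩
        coeff p zero - coeff p zero * (γ * coeff i₀ zero)  ≈⟨ +-congˡ (-‿cong (*-congˡ (trans (*-comm _ _) (proj₂ (inverse _ pivot≉0))))) ⟩
        coeff p zero - coeff p zero * 1#                   ≈⟨ +-congˡ (-‿cong (*-identityʳ _)) ⟩
        coeff p zero - coeff p zero                        ≈⟨ -‿inverseʳ _ ⟩
        0#                                                 ∎

    u′-independent : Independent u′
    u′-independent α u′α≈0 i = do
        μ≈0 ← u-independent μ uμ≈0 (punchIn i₀ i)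
        pure (trans (reflexive (≡.sym (insertAt-punchIn α i₀ (- S) i))) μ≈0)
      where
      S = sum λ i → α i * e i
      μ = insertAt α i₀ (- S)
      uμ≈0 : linComb u μ ≋ 0v
      uμ≈0 t = begin
        linComb u μ t                                ≈⟨ linComb-insertAt u α i₀ (- S) t ⟩
        - S * u i₀ t + linComb (u ∘ punchIn i₀) α t  ≈⟨ +-comm _ _ ⟩
        linComb (u ∘ punchIn i₀) α t + - S * u i₀ t  ≈⟨ +-congˡ (-‿distribˡ-* S (u i₀ t)) ⟨
        linComb (u ∘ punchIn i₀) α t - S * u i₀ t    ≈⟨ linComb-shear (u ∘ punchIn i₀) e (u i₀) α t ⟨
        linComb u′ α t                               ≈⟨ u′α≈0 t ⟩
        0#                                           ∎

  steinitz : ∀ {N} s {k} (w : Fin s → Vector A N) (u : Fin k → Vector A N) →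
             Independent u → (∀ i → InSpan w (u i)) → ¬ ¬ k ≤ s
  steinitz s {zero} w u _ _ = pure z≤n
  steinitz zero {suc k} w u u-independent u∈span = do
      1≈0 ← u-independent (λ _ → 1#) u1≈0 zero
      contradiction 1≈0 1≉0
    where
    u1≈0 : linComb u (λ _ → 1#) ≋ 0v
    u1≈0 t = sum-zero {suc k} λ i → trans (*-congˡ (proj₂ (u∈span i) t)) (zeroʳ 1#)
  steinitz (suc s) {suc k} w u u-independent u∈span =
    ¬¬-all-or-counterexample (λ i → coeff i zero ≈ 0#) >>= λ where
      (inj₁ coeff₀≈0) → do
        k+1≤s ← steinitz s (w ∘ suc) u u-independent λ i →
          coeff i ∘ suc , λ t → trans (proj₂ (u∈span i) t) (linComb-headless w (coeff i) (coeff₀≈0 i) t)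
        pure (m≤n⇒m≤1+n k+1≤s)
      (inj₂ (i₀ , pivot≉0)) → do
        let open Exchange w u u-independent coeff (proj₂ ∘ u∈span) i₀ pivot≉0
        k≤s ← steinitz s (w ∘ suc) u′ u′-independent u′-inSpan
        pure (s≤s k≤s)
    where
    coeff : Fin (suc k) → Vector A (suc s)
    coeff = proj₁ ∘ u∈span

  independent-∷ : ∀ {k n} {u : Fin k → Vector A n} {x} → Independent u → ¬ InSpan u x → Independent (x ∷ u)
  independent-∷ {u = u} {x} u-independent x∉span α lc≈0 i = α₀≈0 >>= λ α₀≈0 → vanish α₀≈0 i
    where
    L : Vector A _
    L = linComb u (α ∘ suc)
    x∈span : ¬ α zero ≈ 0# → InSpan u x
    x∈span α₀≉0 = (λ j → - (δ * α (suc j))) , λ t → begin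
        x t                         ≈⟨ *-identityˡ _ ⟨
        1# * x t                    ≈⟨ *-congʳ (trans (*-comm _ _) (proj₂ (inverse _ α₀≉0))) ⟨
        δ * α zero * x t            ≈⟨ *-assoc _ _ _ ⟩
        δ * (α zero * x t)          ≈⟨ *-congˡ (+-inverseˡ-unique _ _ (lc≈0 t)) ⟩
        δ * - L t                   ≈⟨ -‿distribʳ-* δ (L t) ⟨
        - (δ * L t)                 ≈⟨ -‿cong (linComb-* u δ (α ∘ suc) t) ⟨
        - linComb u (λ j → δ * α (suc j)) t          ≈⟨ linComb-neg u (λ j → δ * α (suc j)) t ⟨
        linComb u (λ j → - (δ * α (suc j))) t        ∎
      where δ = proj₁ (inverse _ α₀≉0)
    α₀≈0 : ¬ ¬ α zero ≈ 0#
    α₀≈0 = ¬¬-excluded-middle >>= λ where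
      (yes α₀≈0) → pure α₀≈0
      (no α₀≉0)  → contradiction (x∈span α₀≉0) x∉span
    vanish : α zero ≈ 0# → ∀ i → ¬ ¬ α i ≈ 0#
    vanish α₀≈0 zero    = pure α₀≈0
    vanish α₀≈0 (suc i) = u-independent (α ∘ suc) (λ t → trans (sym (linComb-headless (x ∷ u) α α₀≈0 t)) (lc≈0 t)) i

  inSpan-∷-head : ∀ {k n} (x : Vector A n) (u : Fin k → Vector A n) → InSpan (x ∷ u) x
  inSpan-∷-head {k} x u = (1# ∷ λ _ → 0#) , λ t → sym (begin
      1# * x t + sum (λ j → 0# * u j t)  ≈⟨ +-cong (*-identityˡ _) (sum-zero {k} λ _ → zeroˡ _) ⟩
      x t + 0#                           ≈⟨ +-identityʳ _ ⟩
      x t                                ∎)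

  inSpan-∷-tail : ∀ {k n} {u : Fin k → Vector A n} {y} x → InSpan u y → InSpan (x ∷ u) y
  inSpan-∷-tail {u = u} x (β , y≋) = (0# ∷ β) , λ t → trans (y≋ t) (sym (linComb-headless (x ∷ u) (0# ∷ β) refl t))

  independent-spanning-subfamily : ∀ {N} a (v : Fin a → Vector A N) →
    ¬ ¬ (Σ[ r ∈ ℕ ] Σ[ g ∈ (Fin r → Fin a) ] Independent (v ∘ g) × (∀ i → InSpan (v ∘ g) (v i)))
  independent-spanning-subfamily zero v = pure (0 , (λ ()) , (λ _ _ ()) , λ ())
  independent-spanning-subfamily (suc a) v = do
    (r , g , independent , spans) ← independent-spanning-subfamily a (v ∘ suc)
    ¬¬-excluded-middle >>= λ where
      (yes v₀∈span) → pure (r , suc ∘ g , independent , λ { zero → v₀∈span ; (suc i) → spans i })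
      (no v₀∉span)  → pure (suc r , zero ∷ suc ∘ g , independent-∷ independent v₀∉span ,
                            λ { zero → inSpan-∷-head (v zero) (v ∘ suc ∘ g) ; (suc i) → inSpan-∷-tail (v zero) (spans i) })

  -- Twist is a relation rather than a ring endomorphism so that p⁻¹-linear maps
  -- (Twist μ κ = μ ≈ κ ^ p) are included.
  record SemilinearMap (a b : ℕ) : Set (c ⊔ lsuc ℓ) where
    field
      f                : Vector A a → Vector A b
      f-cong           : ∀ {x y} → x ≋ y → f x ≋ f y
      f-+              : ∀ x y → f (λ t → x t + y t) ≋ (λ t → f x t + f y t)
      Twist            : A → A → Set ℓ
      f-twisted        : ∀ {μ κ} → Twist μ κ → ∀ x → f (λ t → μ * x t) ≋ (λ t → κ * f x t)
      twist-total      : ∀ μ → ∃ (Twist μ)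
      twist-surjective : ∀ κ → ∃ λ μ → Twist μ κ
      twist-reflects-0 : ∀ {μ κ} → Twist μ κ → κ ≈ 0# → ¬ ¬ μ ≈ 0#

    f-0 : f 0v ≋ 0v
    f-0 t = x+x≈x⇒x≈0 (f 0v t) (sym (trans (f-cong (λ _ → sym (+-identityˡ 0#)) t) (f-+ 0v 0v t)))

    f-linComb : ∀ {k} (x : Fin k → Vector A a) μ κ → (∀ i → Twist (μ i) (κ i)) → f (linComb x μ) ≋ linComb (f ∘ x) κ
    f-linComb {zero}  x μ κ twist t = trans (f-cong (λ _ → refl) t) (f-0 t)
    f-linComb {suc k} x μ κ twist t = begin
      f (linComb x μ) t
        ≈⟨ f-+ (λ t → μ zero * x zero t) (linComb (x ∘ suc) (μ ∘ suc)) t ⟩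
      f (λ t → μ zero * x zero t) t + f (linComb (x ∘ suc) (μ ∘ suc)) t
        ≈⟨ +-cong (f-twisted (twist zero) (x zero) t) (f-linComb (x ∘ suc) (μ ∘ suc) (κ ∘ suc) (twist ∘ suc) t) ⟩
      linComb (f ∘ x) κ t ∎

    f-sub : ∀ x y → f (λ t → x t - y t) ≋ (λ t → f x t - f y t)
    f-sub x y t = trans (f-+ x (λ t → - y t) t) (+-congˡ (+-inverseˡ-unique _ _ (begin
      f (λ t → - y t) t + f y t    ≈⟨ f-+ (λ t → - y t) y t ⟨
      f (λ t → - y t + y t) t      ≈⟨ f-cong (λ t → -‿inverseˡ (y t)) t ⟩
      f 0v t                       ≈⟨ f-0 t ⟩
      0#                           ∎)))

  record HasRank {a b} (S : SemilinearMap a b) (r : ℕ) : Set (c ⊔ ℓ) where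
    field
      preimage    : Fin r → Vector A a
      independent : Independent (SemilinearMap.f S ∘ preimage)
      spans       : ∀ v → InSpan (SemilinearMap.f S ∘ preimage) (SemilinearMap.f S v)

  rank-exists : ∀ {a b} (S : SemilinearMap a b) → ¬ ¬ Σ ℕ (HasRank S)
  rank-exists {a} S = do
      (r , g , independent , spans) ← independent-spanning-subfamily a (f ∘ basis)
      pure (r , record { preimage = basis ∘ g ; independent = independent ; spans = λ v → _ , λ t → begin
        f v t                         ≈⟨ f-cong (λ t → sym (linComb-basis v t)) t ⟩
        f (linComb basis v) t         ≈⟨ f-linComb basis v (κ v) (twist v) t ⟩
        linComb (f ∘ basis) (κ v) t   ≈⟨ linComb-linComb (f ∘ basis) (f ∘ basis ∘ g) (proj₁ ∘ spans) (proj₂ ∘ spans) (κ v) t ⟩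
        _                             ∎ })
    where
    open SemilinearMap S
    κ : Vector A a → Vector A a
    κ v i = proj₁ (twist-total (v i))
    twist : ∀ v i → Twist (v i) (κ v i)
    twist v i = proj₂ (twist-total (v i))

  rank-of-trivial-domain : ∀ {a b} → a ≡ 0 → (S : SemilinearMap a b) → HasRank S 0
  rank-of-trivial-domain ≡.refl S = record
    { preimage = λ ()
    ; independent = λ _ _ ()
    ; spans = λ v → (λ ()) , λ t → trans (SemilinearMap.f-cong S (λ ()) t) (SemilinearMap.f-0 S t)
    }

  Fin-++-elim : ∀ {p m n} {P : Fin (m ℕ.+ n) → Set p} → (∀ i → P (i ↑ˡ n)) → (∀ j → P (m ↑ʳ j)) → ∀ i → P i
  Fin-++-elim {m = zero}  Pˡ Pʳ i       = Pʳ i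
  Fin-++-elim {m = suc m} Pˡ Pʳ zero    = Pˡ zero
  Fin-++-elim {m = suc m} Pˡ Pʳ (suc i) = Fin-++-elim (Pˡ ∘ suc) Pʳ i

  sum-++ : ∀ {m k} (f : Vector A (m ℕ.+ k)) → sum f ≈ sum (f ∘ (_↑ˡ k)) + sum (f ∘ (m ↑ʳ_))
  sum-++ {zero}  f = sym (+-identityˡ _)
  sum-++ {suc m} f = trans (+-congˡ (sum-++ {m} (f ∘ suc))) (sym (+-assoc _ _ _))

  linComb-++ : ∀ {m k n} (u : Fin m → Vector A n) (v : Fin k → Vector A n) α t →
               linComb (u ++ v) α t ≈ linComb u (α ∘ (_↑ˡ k)) t + linComb v (α ∘ (m ↑ʳ_)) t
  linComb-++ {m} {k} u v α t = trans (sum-++ {m} (λ i → α i * (u ++ v) i t))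
    (+-cong (sum-cong-≋ {m} λ i → *-congˡ (reflexive (≡.cong (λ w → w t) (lookup-++ˡ u v i))))
            (sum-cong-≋ {k} λ i → *-congˡ (reflexive (≡.cong (λ w → w t) (lookup-++ʳ u v i)))))

  module _ {a b c′} (S : SemilinearMap a b) (T : SemilinearMap c′ a)
           (ker⊆im : ∀ v → SemilinearMap.f S v ≋ 0v → ∃ λ y → SemilinearMap.f T y ≋ v)
           (im⊆ker : ∀ y → SemilinearMap.f S (SemilinearMap.f T y) ≋ 0v)
           {r₁ r₂} (rank-S : HasRank S r₁) (rank-T : HasRank T r₂) where

    private
      module S = SemilinearMap S
      module T = SemilinearMap T
      module S-rank = HasRank rank-S
      module T-rank = HasRank rank-T
      x = S-rank.preimage
      y = T-rank.preimage

      -- The images of a basis of im T together with preimages of a basis of im S form a basis.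
      z : Fin (r₂ ℕ.+ r₁) → Vector A a
      z = (T.f ∘ y) ++ x

      z-spans : ∀ v → InSpan z v
      z-spans v = β ++ μ , λ t → begin
          v t                                                  ≈⟨ +-identityʳ _ ⟨
          v t + 0#                                             ≈⟨ +-congˡ (-‿inverseˡ _) ⟨
          v t + (- linComb x μ t + linComb x μ t)              ≈⟨ +-assoc _ _ _ ⟨
          v t - linComb x μ t + linComb x μ t                  ≈⟨ +-congʳ (proj₂ v-xμ∈imT t) ⟨
          T.f y′ t + linComb x μ t                             ≈⟨ +-congʳ (proj₂ (T-rank.spans y′) t) ⟩
          linComb (T.f ∘ y) β t + linComb x μ t                ≈⟨ +-cong (linComb-cong (T.f ∘ y) (λ i → reflexive (lookup-++ˡ β μ i)) t)
                                                                         (linComb-cong x (λ i → reflexive (lookup-++ʳ β μ i)) t) ⟨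
          linComb (T.f ∘ y) ((β ++ μ) ∘ (_↑ˡ r₁)) t + linComb x ((β ++ μ) ∘ (r₂ ↑ʳ_)) t
                                                               ≈⟨ linComb-++ (T.f ∘ y) x (β ++ μ) t ⟨
          linComb z (β ++ μ) t                                 ∎
        where
        ν = proj₁ (S-rank.spans v)
        μ = λ j → proj₁ (S.twist-surjective (ν j))
        v-xμ∈imT : ∃ λ y′ → T.f y′ ≋ λ t → v t - linComb x μ t
        v-xμ∈imT = ker⊆im _ λ t → begin
          S.f (λ t → v t - linComb x μ t) t          ≈⟨ S.f-sub v (linComb x μ) t ⟩
          S.f v t - S.f (linComb x μ) t              ≈⟨ +-cong (proj₂ (S-rank.spans v) t)
                                                               (-‿cong (S.f-linComb x μ ν (λ j → proj₂ (S.twist-surjective (ν j))) t)) ⟩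
          linComb (S.f ∘ x) ν t - linComb (S.f ∘ x) ν t  ≈⟨ -‿inverseʳ _ ⟩
          0#                                         ∎
        y′ = proj₁ v-xμ∈imT
        β = proj₁ (T-rank.spans y′)

      z-independent : Independent z
      z-independent α zα≈0 = Fin-++-elim (λ j → ¬¬-∀Fin α₂≈0 >>= λ all → T-rank.independent α₁ (Tyα₁≈0 all) j) α₂≈0
        where
        α₁ = α ∘ (_↑ˡ r₁)
        α₂ = α ∘ (r₂ ↑ʳ_)
        μ₁ = λ i → proj₁ (T.twist-surjective (α₁ i))
        κ₂ = λ j → proj₁ (S.twist-total (α₂ j))
        split≈0 : ∀ t → linComb (T.f ∘ y) α₁ t + linComb x α₂ t ≈ 0#
        split≈0 t = trans (sym (linComb-++ (T.f ∘ y) x α t)) (zα≈0 t)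
        Sxκ₂≈0 : linComb (S.f ∘ x) κ₂ ≋ 0v
        Sxκ₂≈0 t = begin
          linComb (S.f ∘ x) κ₂ t                                ≈⟨ S.f-linComb x α₂ κ₂ (λ j → proj₂ (S.twist-total (α₂ j))) t ⟨
          S.f (linComb x α₂) t                                  ≈⟨ +-identityˡ _ ⟨
          0# + S.f (linComb x α₂) t                             ≈⟨ +-congʳ (trans (S.f-cong Tyα₁≋ t) (im⊆ker (linComb y μ₁) t)) ⟨
          S.f (linComb (T.f ∘ y) α₁) t + S.f (linComb x α₂) t  ≈⟨ S.f-+ (linComb (T.f ∘ y) α₁) (linComb x α₂) t ⟨
          S.f (λ t → linComb (T.f ∘ y) α₁ t + linComb x α₂ t) t ≈⟨ S.f-cong split≈0 t ⟩
          S.f 0v t                                              ≈⟨ S.f-0 t ⟩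
          0#                                                    ∎
          where
          Tyα₁≋ : linComb (T.f ∘ y) α₁ ≋ T.f (linComb y μ₁)
          Tyα₁≋ t = sym (T.f-linComb y μ₁ α₁ (λ i → proj₂ (T.twist-surjective (α₁ i))) t)
        α₂≈0 : ∀ j → ¬ ¬ α₂ j ≈ 0#
        α₂≈0 j = S-rank.independent κ₂ Sxκ₂≈0 j >>= S.twist-reflects-0 (proj₂ (S.twist-total (α₂ j)))
        Tyα₁≈0 : (∀ j → α₂ j ≈ 0#) → linComb (T.f ∘ y) α₁ ≋ 0v
        Tyα₁≈0 all t = begin
          linComb (T.f ∘ y) α₁ t                       ≈⟨ +-identityʳ _ ⟨
          linComb (T.f ∘ y) α₁ t + 0#                  ≈⟨ +-congˡ (sum-zero {r₁} λ j → trans (*-congʳ (all j)) (zeroˡ _)) ⟨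
          linComb (T.f ∘ y) α₁ t + linComb x α₂ t      ≈⟨ split≈0 t ⟩
          0#                                           ∎

    exact⇒dim≡rank+rank : a ≡ r₂ ℕ.+ r₁
    exact⇒dim≡rank+rank = decidable-stable (a ℕ.≟ r₂ ℕ.+ r₁) do
      z-length≤a ← steinitz a basis z z-independent (basis-spans ∘ z)
      a≤z-length ← steinitz (r₂ ℕ.+ r₁) z basis basis-independent (z-spans ∘ basis)
      pure (≤-antisym a≤z-length z-length≤a)

module RangeSums where

  open import Function using (_∘_)
  open import Data.Nat using (zero; suc; _+_; _*_; _≤_; _<_; z≤n; s≤s)
  open import Data.Nat.Properties
  open import Data.Nat.ListAction using (sum)
  open import Data.List using ([]; _∷_; map; filter)
  open import Relation.Nullary using (Dec; yes; no; contradiction)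
  open import Relation.Unary using (Pred; Decidable)
  open import Relation.Binary.PropositionalEquality
  open import Algebra.Properties.CommutativeSemigroup +-commutativeSemigroup using () renaming (interchange to +-interchange)
  open ≡-Reasoning

  keepIf : ∀ {p} {P : Set p} → Dec P → ℕ → ℕ
  keepIf (yes _) v = v
  keepIf (no _)  v = 0

  keepIf-≤ : ∀ {p} {P : Set p} (P? : Dec P) v → keepIf P? v ≤ v
  keepIf-≤ (yes _) v = ≤-refl
  keepIf-≤ (no _)  v = z≤n

  keepIf-+ : ∀ {p} {P : Set p} (P? : Dec P) v w → keepIf P? (v + w) ≡ keepIf P? v + keepIf P? w
  keepIf-+ (yes _) v w = refl
  keepIf-+ (no _)  v w = refl

  keepIf-⇔ : ∀ {p q} {P : Set p} {Q : Set q} (P? : Dec P) (Q? : Dec Q) → (P → Q) → (Q → P) → ∀ v → keepIf P? v ≡ keepIf Q? v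
  keepIf-⇔ (yes _) (yes _) _   _   v = refl
  keepIf-⇔ (yes p) (no ¬q) p→q _   v = contradiction (p→q p) ¬q
  keepIf-⇔ (no ¬p) (yes q) _   q→p v = contradiction (q→p q) ¬p
  keepIf-⇔ (no _)  (no _)  _   _   v = refl

  sum-filter : ∀ {a p} {A : Set a} {P : Pred A p} (P? : Decidable P) (g : A → ℕ) xs →
               sum (map g (filter P? xs)) ≡ sum (map (λ x → keepIf (P? x) (g x)) xs)
  sum-filter P? g [] = refl
  sum-filter P? g (x ∷ xs) with P? x
  ... | yes _ = cong (g x ℕ.+_) (sum-filter P? g xs)
  ... | no _  = sum-filter P? g xs

  sumBelow : ℕ → (ℕ → ℕ) → ℕ
  sumBelow zero    h = 0
  sumBelow (suc K) h = h 0 + sumBelow K (h ∘ suc)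

  sumBelow-cong : ∀ K {h h′ : ℕ → ℕ} → (∀ t → t < K → h t ≡ h′ t) → sumBelow K h ≡ sumBelow K h′
  sumBelow-cong zero    eq = refl
  sumBelow-cong (suc K) eq = cong₂ _+_ (eq 0 (s≤s z≤n)) (sumBelow-cong K λ t t<K → eq (suc t) (s≤s t<K))

  sumBelow-+ : ∀ K (h h′ : ℕ → ℕ) → sumBelow K (λ t → h t + h′ t) ≡ sumBelow K h + sumBelow K h′
  sumBelow-+ zero    h h′ = refl
  sumBelow-+ (suc K) h h′ =
    trans (cong (h 0 + h′ 0 ℕ.+_) (sumBelow-+ K (h ∘ suc) (h′ ∘ suc))) (+-interchange (h 0) (h′ 0) _ _)

  sumBelow-const : ∀ K v → sumBelow K (λ _ → v) ≡ K * v
  sumBelow-const zero    v = refl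
  sumBelow-const (suc K) v = cong (v ℕ.+_) (sumBelow-const K v)

  sumBelow-zero : ∀ K {h : ℕ → ℕ} → (∀ t → t < K → h t ≡ 0) → sumBelow K h ≡ 0
  sumBelow-zero K h≡0 = trans (sumBelow-cong K h≡0) (trans (sumBelow-const K 0) (*-zeroʳ K))

  sumBelow-split : ∀ a b (h : ℕ → ℕ) → sumBelow (a + b) h ≡ sumBelow a h + sumBelow b (λ t → h (a + t))
  sumBelow-split zero    b h = refl
  sumBelow-split (suc a) b h = trans (cong (h 0 ℕ.+_) (sumBelow-split a b (h ∘ suc))) (sym (+-assoc (h 0) _ _))

  sumBelow-supported : ∀ a K b (h : ℕ → ℕ) → (∀ t → t < a → h t ≡ 0) → (∀ t → h (a + K + t) ≡ 0) →
                       sumBelow (a + K + b) h ≡ sumBelow K (λ t → h (a + t))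
  sumBelow-supported a K b h below above = begin
    sumBelow (a + K + b) h                                        ≡⟨ sumBelow-split (a + K) b h ⟩
    sumBelow (a + K) h + sumBelow b (λ t → h (a + K + t))         ≡⟨ cong (sumBelow (a + K) h ℕ.+_) (sumBelow-zero b λ t _ → above t) ⟩
    sumBelow (a + K) h + 0                                        ≡⟨ +-identityʳ _ ⟩
    sumBelow (a + K) h                                            ≡⟨ sumBelow-split a K h ⟩
    sumBelow a h + sumBelow K (λ t → h (a + t))                   ≡⟨ cong (_+ sumBelow K (λ t → h (a + t))) (sumBelow-zero a below) ⟩
    sumBelow K (λ t → h (a + t))                                  ∎

  sumBelow-unique : ∀ {p} {P : Pred ℕ p} (P? : Decidable P) K r v → r < K → P r → (∀ t → t < K → P t → t ≡ r) →
                    sumBelow K (λ t → keepIf (P? t) v) ≡ v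
  sumBelow-unique P? (suc K) zero v _ P0 unique with P? 0
  ... | no ¬P0 = contradiction P0 ¬P0
  ... | yes _  = trans (cong (v ℕ.+_) (sumBelow-zero K off)) (+-identityʳ v)
    where
    off : ∀ t → t < K → keepIf (P? (suc t)) v ≡ 0
    off t t<K with P? (suc t)
    ... | yes Pt = contradiction (unique (suc t) (s≤s t<K) Pt) λ ()
    ... | no _   = refl
  sumBelow-unique P? (suc K) (suc r) v (s≤s r<K) Pr unique with P? 0
  ... | yes P0 = contradiction (unique 0 (s≤s z≤n) P0) λ ()
  ... | no _   = sumBelow-unique (P? ∘ suc) K r v r<K Pr λ t t<K Pt → suc-injective (unique (suc t) (s≤s t<K) Pt)

module WindowSums where

  open import Function using (_∘_)
  open import Data.Nat using (zero; suc; _+_; _≤_; _<_; s≤s)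
  open import Data.Nat.Properties
  open import Data.Nat.ListAction using (sum)
  import Data.Integer.Properties as ℤ
  open import Data.Integer.Tactic.RingSolver using (solve-∀)
  import Data.Nat.Tactic.RingSolver as ℕ-Solver
  open import Data.List using (List; map; upTo; applyUpTo)
  open import Data.Product using (_,_)
  open import Data.List.Membership.Propositional using (_∈_)
  open import Data.List.Membership.Propositional.Properties using (∈-map⁺; ∈-upTo⁺)
  open import Relation.Binary.PropositionalEquality
  open ≡-Reasoning
  open RangeSums

  window : ℕ → List ℤ
  window N = map (λ t → + t ℤ.- + N) (upTo (suc (N + N)))

  private
    [a+b]-b≡a : ∀ (a b : ℤ) → (a ℤ.+ b) ℤ.- b ≡ a
    [a+b]-b≡a = solve-∀
    [a-b]-a≡-b : ∀ (a b : ℤ) → (a ℤ.- b) ℤ.- a ≡ ℤ.- b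
    [a-b]-a≡-b = solve-∀

  ∈-window : ∀ {N} i → ℤ.∣ i ∣ ≤ N → i ∈ window N
  ∈-window {N} (+ k) k≤N = subst (_∈ window N) ([a+b]-b≡a (+ k) (+ N))
    (subst (λ x → x ℤ.- + N ∈ window N) (ℤ.pos-+ k N) (∈-map⁺ (λ t → + t ℤ.- + N) (∈-upTo⁺ (s≤s (+-monoˡ-≤ N k≤N)))))
  ∈-window {N} ℤ.-[1+ k ] k<N = subst (_∈ window N) ([a-b]-a≡-b (+ N) (+ suc k))
    (subst (λ x → x ℤ.- + N ∈ window N) (trans (sym (ℤ.⊖-≥ k<N)) (sym (ℤ.m-n≡m⊖n N (suc k))))
      (∈-map⁺ (λ t → + t ℤ.- + N) (∈-upTo⁺ (s≤s (≤-trans (m∸n≤m N (suc k)) (m≤m+n N N))))))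

  windowSum : ℕ → (ℤ → ℕ) → ℕ
  windowSum N g = sumBelow (suc (N + N)) (λ t → g (+ t ℤ.- + N))

  sum-window : ∀ N g → sum (map g (window N)) ≡ windowSum N g
  sum-window N g = go (suc (N + N)) (λ t → t)
    where
    go : ∀ K f → sum (map g (map (λ t → + t ℤ.- + N) (applyUpTo f K))) ≡ sumBelow K (λ t → g (+ f t ℤ.- + N))
    go zero    f = refl
    go (suc K) f = cong (g (+ f 0 ℤ.- + N) ℕ.+_) (go K (f ∘ suc))

  windowSum-cong : ∀ N {g g′ : ℤ → ℕ} → (∀ i → g i ≡ g′ i) → windowSum N g ≡ windowSum N g′
  windowSum-cong N eq = sumBelow-cong (suc (N + N)) λ t _ → eq (+ t ℤ.- + N)

  windowSum-+ : ∀ N (g g′ : ℤ → ℕ) → windowSum N (λ i → g i + g′ i) ≡ windowSum N g + windowSum N g′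
  windowSum-+ N g g′ = sumBelow-+ (suc (N + N)) (λ t → g (+ t ℤ.- + N)) (λ t → g′ (+ t ℤ.- + N))

  Supported : ℕ → (ℤ → ℕ) → Set
  Supported N g = ∀ i → N < ℤ.∣ i ∣ → g i ≡ 0

  supported-≤ : ∀ {N} {g h : ℤ → ℕ} → (∀ i → g i ≤ h i) → Supported N h → Supported N g
  supported-≤ {g = g} g≤h h-supp i N<∣i∣ = n≤0⇒n≡0 (subst (g i ≤_) (h-supp i N<∣i∣) (g≤h i))

  private
    a-[a+b]≡-b : ∀ (a b : ℤ) → a ℤ.- (a ℤ.+ b) ≡ ℤ.- b
    a-[a+b]≡-b = solve-∀
    [a+b]-a≡b : ∀ (a b : ℤ) → (a ℤ.+ b) ℤ.- a ≡ b
    [a+b]-a≡b = solve-∀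
    [a+b]-[a+c]≡b-c : ∀ (a b c : ℤ) → (a ℤ.+ b) ℤ.- (a ℤ.+ c) ≡ b ℤ.- c
    [a+b]-[a+c]≡b-c = solve-∀
    a-b+c≡[c+a]-b : ∀ (a b c : ℤ) → a ℤ.- b ℤ.+ c ≡ (c ℤ.+ a) ℤ.- b
    a-b+c≡[c+a]-b = solve-∀

  ∣m-[m+k]∣≡k : ∀ m k → ℤ.∣ + m ℤ.- + (m + k) ∣ ≡ k
  ∣m-[m+k]∣≡k m k = begin
    ℤ.∣ + m ℤ.- + (m + k) ∣      ≡⟨ cong (λ x → ℤ.∣ + m ℤ.- x ∣) (ℤ.pos-+ m k) ⟩
    ℤ.∣ + m ℤ.- (+ m ℤ.+ + k) ∣  ≡⟨ cong ℤ.∣_∣ (a-[a+b]≡-b (+ m) (+ k)) ⟩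
    ℤ.∣ ℤ.- + k ∣                ≡⟨ ℤ.∣-i∣≡∣i∣ (+ k) ⟩
    k                            ∎

  ∣[m+k]-m∣≡k : ∀ m k → ℤ.∣ + (m + k) ℤ.- + m ∣ ≡ k
  ∣[m+k]-m∣≡k m k = cong ℤ.∣_∣ (trans (cong (ℤ._- + m) (ℤ.pos-+ m k)) ([a+b]-a≡b (+ m) (+ k)))

  below-window : ∀ {N t M} → t + suc N ≤ M → N < ℤ.∣ + t ℤ.- + M ∣
  below-window {N} {t} t+N<M with m≤n⇒∃[o]m+o≡n t+N<M
  ... | f , refl = subst (N <_) (sym (trans (cong (λ x → ℤ.∣ + t ℤ.- + x ∣) (+-assoc t (suc N) f)) (∣m-[m+k]∣≡k t (suc N + f))))
                         (s≤s (m≤m+n N f))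

  above-window : ∀ {N t M} → M + suc N ≤ t → N < ℤ.∣ + t ℤ.- + M ∣
  above-window {N} {t} {M} M+N<t with m≤n⇒∃[o]m+o≡n M+N<t
  ... | f , refl = subst (N <_) (sym (trans (cong (λ x → ℤ.∣ + x ℤ.- + M ∣) (+-assoc M (suc N) f)) (∣[m+k]-m∣≡k M (suc N + f))))
                         (s≤s (m≤m+n N f))

  windowSum-extend : ∀ {N g} → Supported N g → ∀ D → windowSum (D + N) g ≡ windowSum N g
  windowSum-extend {N} {g} g-supp D = begin
    sumBelow (suc (D + N + (D + N))) h          ≡⟨ cong (λ K → sumBelow K h) (length-identity D N) ⟩
    sumBelow (D + suc (N + N) + D) h            ≡⟨ sumBelow-supported D (suc (N + N)) D h below above ⟩
    sumBelow (suc (N + N)) (λ t → h (D + t))    ≡⟨ sumBelow-cong (suc (N + N)) (λ t _ → cong g (recentre t)) ⟩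
    windowSum N g                               ∎
    where
    h = λ t → g (+ t ℤ.- + (D + N))
    length-identity : ∀ D N → suc (D + N + (D + N)) ≡ D + suc (N + N) + D
    length-identity = ℕ-Solver.solve-∀
    below : ∀ t → t < D → h t ≡ 0
    below t t<D = g-supp _ (below-window (subst (_≤ D + N) (sym (+-suc t N)) (+-monoˡ-≤ N t<D)))
    above : ∀ t → h (D + suc (N + N) + t) ≡ 0
    above t = g-supp _ (above-window (subst (_≤ D + suc (N + N) + t) (sym (trans (+-assoc D N (suc N)) (cong (D ℕ.+_) (+-suc N N)))) (m≤m+n _ t)))
    recentre : ∀ t → + (D + t) ℤ.- + (D + N) ≡ + t ℤ.- + N
    recentre t = trans (cong₂ ℤ._-_ (ℤ.pos-+ D t) (ℤ.pos-+ D N)) ([a+b]-[a+c]≡b-c (+ D) (+ t) (+ N))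

  windowSum-shift : ∀ {N g} → Supported N g → ∀ s M → N + s ≤ M → windowSum M (λ i → g (i ℤ.+ + s)) ≡ windowSum M g
  windowSum-shift {N} {g} g-supp s M N+s≤M = begin
    windowSum M (λ i → g (i ℤ.+ + s))    ≡⟨ sumBelow-cong K (λ t _ → cong g (shifted t)) ⟩
    sumBelow K (λ t → h (s + t))         ≡⟨ sumBelow-supported s K 0 h below (λ t → above (≤-trans (m≤n+m K s) (m≤m+n _ t))) ⟨
    sumBelow (s + K + 0) h               ≡⟨ cong (λ L → sumBelow L h) (trans (+-identityʳ (s + K)) (+-comm s K)) ⟩
    sumBelow (K + s) h                   ≡⟨ sumBelow-supported 0 K s h (λ _ ()) (λ t → above (m≤m+n K t)) ⟩
    windowSum M g                        ∎
    where
    K = suc (M + M)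
    h = λ t → g (+ t ℤ.- + M)
    shifted : ∀ t → + t ℤ.- + M ℤ.+ + s ≡ + (s + t) ℤ.- + M
    shifted t = trans (a-b+c≡[c+a]-b (+ t) (+ M) (+ s)) (cong (ℤ._- + M) (sym (ℤ.pos-+ s t)))
    below : ∀ t → t < s → h t ≡ 0
    below t t<s = g-supp _ (below-window (≤-trans (subst (_≤ s + N) (sym (+-suc t N)) (+-monoˡ-≤ N t<s))
                                                   (subst (_≤ M) (+-comm N s) N+s≤M)))
    above : ∀ {x} → K ≤ x → h x ≡ 0
    above {x} K≤x = g-supp _ (above-window (≤-trans (+-monoʳ-≤ M (s≤s (m+n≤o⇒m≤o N N+s≤M))) (subst (_≤ x) (sym (+-suc M M)) K≤x)))

  windowSum-shift-supported : ∀ {N g} s → Supported N g → Supported N (λ i → g (i ℤ.+ + s)) →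
                              windowSum N (λ i → g (i ℤ.+ + s)) ≡ windowSum N g
  windowSum-shift-supported {N} {g} s g-supp g+s-supp = begin
    windowSum N (λ i → g (i ℤ.+ + s))         ≡⟨ windowSum-extend g+s-supp s ⟨
    windowSum (s + N) (λ i → g (i ℤ.+ + s))   ≡⟨ windowSum-shift g-supp s (s + N) (≤-reflexive (+-comm N s)) ⟩
    windowSum (s + N) g                       ≡⟨ windowSum-extend g-supp s ⟩
    windowSum N g                             ∎

module ResidueClasses (q : ℕ) where
  open import Data.Nat using (zero; suc; _+_; _*_; _<_; NonZero; ∣_-_∣)
  open import Data.Nat.Properties
  open import Data.Nat.Divisibility using (_∣_; _∣?_; >⇒∤)
  open import Data.Nat.ListAction using (sum)
  import Data.Integer.Properties as ℤ
  import Data.Integer.Divisibility.Signed as ℤ∣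
  open import Data.Integer.DivMod using (_%ℕ_; _/ℕ_; n%ℕd<d; a≡a%ℕn+[a/ℕn]*n)
  open import Data.Integer.Tactic.RingSolver using (solve-∀)
  open import Data.List using ([]; _∷_; map; filter)
  open import Data.Sum using (inj₁; inj₂)
  open import Relation.Nullary using (contradiction)
  open import Relation.Binary.PropositionalEquality
  open ≡-Reasoning
  open RangeSums
  open WindowSums

  classSum : ℕ → (ℤ → ℕ) → ℤ → ℕ
  classSum N g j = windowSum N (λ i → keepIf (q ∣? ℤ.∣ i ℤ.- j ∣) (g i))

  private
    [i+s]-[j+s]≡i-j : ∀ (i j s : ℤ) → (i ℤ.+ s) ℤ.- (j ℤ.+ s) ≡ i ℤ.- j
    [i+s]-[j+s]≡i-j = solve-∀
    [i+s]-s≡i : ∀ (i s : ℤ) → (i ℤ.+ s) ℤ.- s ≡ i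
    [i+s]-s≡i = solve-∀
    i-j≡[i-[j+q]]+q : ∀ (i j q : ℤ) → i ℤ.- j ≡ (i ℤ.- (j ℤ.+ q)) ℤ.+ q
    i-j≡[i-[j+q]]+q = solve-∀
    [x-t]-[x-r]≡r-t : ∀ (x t r : ℤ) → (x ℤ.- t) ℤ.- (x ℤ.- r) ≡ r ℤ.- t
    [x-t]-[x-r]≡r-t = solve-∀
    [r+k*q]-r≡k*q : ∀ (r k q : ℤ) → (r ℤ.+ k ℤ.* q) ℤ.- r ≡ k ℤ.* q
    [r+k*q]-r≡k*q = solve-∀

  classSum-sum-filter : ∀ N g j → sum (map g (filter (λ i → q ∣? ℤ.∣ i ℤ.- j ∣) (window N))) ≡ classSum N g j
  classSum-sum-filter N g j = trans (sum-filter (λ i → q ∣? ℤ.∣ i ℤ.- j ∣) g (window N)) (sum-window N _)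

  classSum-cong : ∀ N {g h : ℤ → ℕ} → (∀ i → g i ≡ h i) → ∀ j → classSum N g j ≡ classSum N h j
  classSum-cong N g≡h j = windowSum-cong N λ i → cong (keepIf (q ∣? ℤ.∣ i ℤ.- j ∣)) (g≡h i)

  classSum-+ : ∀ N (g h : ℤ → ℕ) j → classSum N (λ i → g i + h i) j ≡ classSum N g j + classSum N h j
  classSum-+ N g h j = trans (windowSum-cong N λ i → keepIf-+ (q ∣? ℤ.∣ i ℤ.- j ∣) (g i) (h i))
                             (windowSum-+ N (λ i → keepIf (q ∣? ℤ.∣ i ℤ.- j ∣) (g i)) (λ i → keepIf (q ∣? ℤ.∣ i ℤ.- j ∣) (h i)))

  classSum-shift : ∀ {N g} s → Supported N g → Supported N (λ i → g (i ℤ.- + s)) →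
                   ∀ j → classSum N (λ i → g (i ℤ.- + s)) (j ℤ.+ + s) ≡ classSum N g j
  classSum-shift {N} {g} s g-supp g-s-supp j = begin
    windowSum N h                        ≡⟨ windowSum-shift-supported s h-supp (supported-≤ (λ i → ≤-reflexive (h[i+s] i)) gⱼ-supp) ⟨
    windowSum N (λ i → h (i ℤ.+ + s))    ≡⟨ windowSum-cong N h[i+s] ⟩
    windowSum N gⱼ                       ∎
    where
    h gⱼ : ℤ → ℕ
    h i = keepIf (q ∣? ℤ.∣ i ℤ.- (j ℤ.+ + s) ∣) (g (i ℤ.- + s))
    gⱼ i = keepIf (q ∣? ℤ.∣ i ℤ.- j ∣) (g i)
    h-supp : Supported N h
    h-supp = supported-≤ (λ i → keepIf-≤ _ _) g-s-supp
    gⱼ-supp : Supported N gⱼ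
    gⱼ-supp = supported-≤ (λ i → keepIf-≤ _ _) g-supp
    h[i+s] : ∀ i → h (i ℤ.+ + s) ≡ gⱼ i
    h[i+s] i = trans (cong (keepIf P?) (cong g ([i+s]-s≡i i (+ s))))
                     (keepIf-⇔ P? (q ∣? ℤ.∣ i ℤ.- j ∣) (subst (q ∣_) ∣same∣) (subst (q ∣_) (sym ∣same∣)) (g i))
      where
      P? = q ∣? ℤ.∣ (i ℤ.+ + s) ℤ.- (j ℤ.+ + s) ∣
      ∣same∣ = cong ℤ.∣_∣ ([i+s]-[j+s]≡i-j i j (+ s))

  classSum-periodic : ∀ N g j → classSum N g (j ℤ.+ + q) ≡ classSum N g j
  classSum-periodic N g j = windowSum-cong N λ i →
    keepIf-⇔ (q ∣? ℤ.∣ i ℤ.- (j ℤ.+ + q) ∣) (q ∣? ℤ.∣ i ℤ.- j ∣) (⇒ i) (⇐ i) (g i)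
    where
    ⇒ : ∀ i → q ∣ ℤ.∣ i ℤ.- (j ℤ.+ + q) ∣ → q ∣ ℤ.∣ i ℤ.- j ∣
    ⇒ i q∣ = ℤ∣.∣⇒∣ᵤ (subst (+ q ℤ∣.∣_) (sym (i-j≡[i-[j+q]]+q i j (+ q)))
                             (ℤ∣.∣m∣n⇒∣m+n {m = i ℤ.- (j ℤ.+ + q)} (ℤ∣.∣ᵤ⇒∣ q∣) ℤ∣.∣-refl))
    ⇐ : ∀ i → q ∣ ℤ.∣ i ℤ.- j ∣ → q ∣ ℤ.∣ i ℤ.- (j ℤ.+ + q) ∣
    ⇐ i q∣ = ℤ∣.∣⇒∣ᵤ (ℤ∣.∣m+n∣n⇒∣m {m = i ℤ.- (j ℤ.+ + q)}
                               (subst (+ q ℤ∣.∣_) (i-j≡[i-[j+q]]+q i j (+ q)) (ℤ∣.∣ᵤ⇒∣ q∣)) ℤ∣.∣-refl)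

  ∣+m-+n∣≡∣m-n∣ : ∀ m n → ℤ.∣ + m ℤ.- + n ∣ ≡ ∣ m - n ∣
  ∣+m-+n∣≡∣m-n∣ m n with ≤-total m n
  ... | inj₁ m≤n = trans (cong ℤ.∣_∣ (ℤ.m-n≡m⊖n m n)) (trans (ℤ.∣⊖∣-≤ m≤n) (sym (m≤n⇒∣m-n∣≡n∸m m≤n)))
  ... | inj₂ n≤m = trans (cong ℤ.∣_∣ (ℤ.m-n≡m⊖n m n))
                         (trans (ℤ.∣m⊖n∣≡∣n⊖m∣ m n) (trans (ℤ.∣⊖∣-≤ n≤m) (sym (m≤n⇒∣n-m∣≡n∸m n≤m))))

  congruent-residues-equal : ∀ {t r} → t < q → r < q → q ∣ ℤ.∣ + r ℤ.- + t ∣ → t ≡ r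
  congruent-residues-equal {t} {r} t<q r<q q∣ =
    sym (∣m-n∣≡0⇒m≡n (multiple-below-q (subst (q ∣_) (∣+m-+n∣≡∣m-n∣ r t) q∣)
                                         (≤-<-trans (∣m-n∣≤m⊔n r t) (⊔-pres-<m r<q t<q))))
    where
    multiple-below-q : ∀ {k} → q ∣ k → k < q → k ≡ 0
    multiple-below-q {zero}  _   _   = refl
    multiple-below-q {suc k} q∣k k<q = contradiction q∣k (>⇒∤ k<q)

  module _ .{{_ : NonZero q}} where

    residue-unique : ∀ x v → sumBelow q (λ r → keepIf (q ∣? ℤ.∣ x ℤ.- + r ∣) v) ≡ v
    residue-unique x v = sumBelow-unique (λ r → q ∣? ℤ.∣ x ℤ.- + r ∣) q (x %ℕ q) v (n%ℕd<d x q) q∣x-r unique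
      where
      q∣x-r : q ∣ ℤ.∣ x ℤ.- + (x %ℕ q) ∣
      q∣x-r = ℤ∣.∣⇒∣ᵤ (subst (+ q ℤ∣.∣_) (sym x-r≡[x/q]*q) (ℤ∣.∣n⇒∣m*n (x /ℕ q) ℤ∣.∣-refl))
        where
        x-r≡[x/q]*q = trans (cong (ℤ._- + (x %ℕ q)) (a≡a%ℕn+[a/ℕn]*n x q)) ([r+k*q]-r≡k*q (+ (x %ℕ q)) (x /ℕ q) (+ q))
      unique : ∀ t → t < q → q ∣ ℤ.∣ x ℤ.- + t ∣ → t ≡ x %ℕ q
      unique t t<q q∣x-t = congruent-residues-equal t<q (n%ℕd<d x q)
        (ℤ∣.∣⇒∣ᵤ (subst (+ q ℤ∣.∣_) ([x-t]-[x-r]≡r-t x (+ t) (+ (x %ℕ q)))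
                         (ℤ∣.∣m∣n⇒∣m-n {m = x ℤ.- + t} {n = x ℤ.- + (x %ℕ q)} (ℤ∣.∣ᵤ⇒∣ q∣x-t) (ℤ∣.∣ᵤ⇒∣ q∣x-r))))

    sum-by-residues : ∀ (g : ℤ → ℕ) xs →
                      sum (map g xs) ≡ sumBelow q (λ r → sum (map g (filter (λ i → q ∣? ℤ.∣ i ℤ.- + r ∣) xs)))
    sum-by-residues g xs = trans (split xs) (sumBelow-cong q λ r _ → sym (sum-filter (λ i → q ∣? ℤ.∣ i ℤ.- + r ∣) g xs))
      where
      split : ∀ xs → sum (map g xs) ≡ sumBelow q (λ r → sum (map (λ i → keepIf (q ∣? ℤ.∣ i ℤ.- + r ∣) (g i)) xs))
      split []       = sym (sumBelow-zero q λ _ _ → refl)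
      split (x ∷ xs) = trans (cong₂ _+_ (sym (residue-unique x (g x))) (split xs)) (sym (sumBelow-+ q _ _))

module _ {a} {X : Set a} (f : ℤ → X) where

  open import Data.Nat using (zero; suc; _+_; _*_)
  import Data.Integer.Properties as ℤ
  open import Data.Integer.Tactic.RingSolver using (solve-∀)
  open import Data.Nat.Coprimality using (Coprime; coprime-Bézout)
  import Data.Nat.Properties as ℕₚ
  open import Data.Nat.GCD using (module Bézout)
  open import Relation.Binary.PropositionalEquality
  open ≡-Reasoning

  private
    j+[s+t]≡[j+t]+s : ∀ (j s t : ℤ) → j ℤ.+ (s ℤ.+ t) ≡ (j ℤ.+ t) ℤ.+ s
    j+[s+t]≡[j+t]+s = solve-∀
    [j+1]+t≡j+[1+t] : ∀ (j t : ℤ) → (j ℤ.+ + 1) ℤ.+ t ≡ j ℤ.+ (+ 1 ℤ.+ t)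
    [j+1]+t≡j+[1+t] = solve-∀

  invariant-under-multiples : ∀ s → (∀ j → f (j ℤ.+ + s) ≡ f j) → ∀ k j → f (j ℤ.+ + (k * s)) ≡ f j
  invariant-under-multiples s inv zero    j = cong f (ℤ.+-identityʳ j)
  invariant-under-multiples s inv (suc k) j = begin
    f (j ℤ.+ + (s + k * s))            ≡⟨ cong f (trans (cong (λ x → j ℤ.+ x) (ℤ.pos-+ s (k * s))) (j+[s+t]≡[j+t]+s j (+ s) (+ (k * s)))) ⟩
    f ((j ℤ.+ + (k * s)) ℤ.+ + s)      ≡⟨ inv _ ⟩
    f (j ℤ.+ + (k * s))                ≡⟨ invariant-under-multiples s inv k j ⟩
    f j                                ∎

  coprime-periods⇒constant : ∀ {n q} → Coprime n q → (∀ j → f (j ℤ.+ + n) ≡ f j) → (∀ j → f (j ℤ.+ + q) ≡ f j) →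
                             ∀ j → f j ≡ f (+ 0)
  coprime-periods⇒constant {n} {q} coprime n-periodic q-periodic = constant
    where
    shift-by : ∀ j k l → 1 + k ≡ l → f ((j ℤ.+ + 1) ℤ.+ + k) ≡ f (j ℤ.+ + l)
    shift-by j k l 1+k≡l = cong f (trans ([j+1]+t≡j+[1+t] j (+ k)) (cong (λ x → j ℤ.+ x) (trans (sym (ℤ.pos-+ 1 k)) (cong +_ 1+k≡l))))
    1-periodic : ∀ j → f (j ℤ.+ + 1) ≡ f j
    1-periodic j with coprime-Bézout coprime
    ... | Bézout.+- x y 1+yq≡xn = begin
      f (j ℤ.+ + 1)                        ≡⟨ invariant-under-multiples q q-periodic y (j ℤ.+ + 1) ⟨
      f ((j ℤ.+ + 1) ℤ.+ + (y * q))        ≡⟨ shift-by j (y * q) (x * n) 1+yq≡xn ⟩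
      f (j ℤ.+ + (x * n))                  ≡⟨ invariant-under-multiples n n-periodic x j ⟩
      f j                                  ∎
    ... | Bézout.-+ x y 1+xn≡yq = begin
      f (j ℤ.+ + 1)                        ≡⟨ invariant-under-multiples n n-periodic x (j ℤ.+ + 1) ⟨
      f ((j ℤ.+ + 1) ℤ.+ + (x * n))        ≡⟨ shift-by j (x * n) (y * q) 1+xn≡yq ⟩
      f (j ℤ.+ + (y * q))                  ≡⟨ invariant-under-multiples q q-periodic y j ⟩
      f j                                  ∎
    constant : ∀ j → f j ≡ f (+ 0)
    constant (+ zero)       = refl
    constant (+ suc k)      = trans (cong f (trans (cong +_ (ℕₚ.+-comm 1 k)) (ℤ.pos-+ k 1))) (trans (1-periodic (+ k)) (constant (+ k)))
    constant ℤ.-[1+ zero ]  = sym (1-periodic ℤ.-[1+ zero ])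
    constant ℤ.-[1+ suc k ] = trans (sym (1-periodic ℤ.-[1+ suc k ])) (constant ℤ.-[1+ k ])

module Counting {n m : ℕ} (coprime : Coprime n m) {N : ℕ} {d A B : ℤ → ℕ} (d-supp : WindowSums.Supported N d)
                (d≡B+A : ∀ j → d j ≡ B (j ℤ.- + m) ℕ.+ A j) (d≡A+B : ∀ j → d j ≡ A (j ℤ.- + n) ℕ.+ B j) where

  open import Data.Nat using (_+_; _*_; _≤_; NonZero)
  open import Data.Nat.Properties using (m≤m+n; m≤n+m; +-comm; *-comm)
  open import Data.Nat.Coprimality using (coprime-+; 0-coprimeTo-m⇒m≡1) renaming (sym to coprime-sym)
  open import Data.Nat.ListAction using (sum)
  import Data.Integer.Properties as ℤ
  open import Data.Integer.Tactic.RingSolver using (solve-∀)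
  open import Data.List using (map; filter)
  open import Data.Nat.Divisibility using (_∣?_)
  open import Relation.Nullary using (contradiction)
  open import Relation.Binary.PropositionalEquality
  open ≡-Reasoning
  open RangeSums
  open WindowSums
  open ResidueClasses (n + m)

  private
    [j+n]+m≡j+[n+m] : ∀ (j n m : ℤ) → (j ℤ.+ n) ℤ.+ m ≡ j ℤ.+ (n ℤ.+ m)
    [j+n]+m≡j+[n+m] = solve-∀

    bounded-by-d : ∀ {g : ℤ → ℕ} → (∀ i → g i ≤ d i) → Supported N g
    bounded-by-d g≤d = supported-≤ g≤d d-supp

    A-supp : Supported N A
    A-supp = bounded-by-d λ i → subst (A i ≤_) (sym (d≡B+A i)) (m≤n+m (A i) _)
    A-n-supp : Supported N (λ i → A (i ℤ.- + n))
    A-n-supp = bounded-by-d λ i → subst (A (i ℤ.- + n) ≤_) (sym (d≡A+B i)) (m≤m+n _ (B i))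
    B-supp : Supported N B
    B-supp = bounded-by-d λ i → subst (B i ≤_) (sym (d≡A+B i)) (m≤n+m (B i) _)
    B-m-supp : Supported N (λ i → B (i ℤ.- + m))
    B-m-supp = bounded-by-d λ i → subst (B (i ℤ.- + m) ≤_) (sym (d≡B+A i)) (m≤m+n _ (A i))

  classSum-+n : ∀ j → classSum N d (j ℤ.+ + n) ≡ classSum N d j
  classSum-+n j = begin
    classSum N d (j ℤ.+ + n)                                          ≡⟨ classSum-cong N d≡A+B (j ℤ.+ + n) ⟩
    classSum N (λ i → A-n i + B i) (j ℤ.+ + n)                        ≡⟨ classSum-+ N A-n B (j ℤ.+ + n) ⟩
    classSum N A-n (j ℤ.+ + n) + classSum N B (j ℤ.+ + n)             ≡⟨ cong₂ _+_ (classSum-shift n A-supp A-n-supp j)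
                                                                                    (sym (classSum-shift m B-supp B-m-supp (j ℤ.+ + n))) ⟩
    classSum N A j + classSum N B-m ((j ℤ.+ + n) ℤ.+ + m)             ≡⟨ cong (λ k → classSum N A j + classSum N B-m k) full-period ⟩
    classSum N A j + classSum N B-m (j ℤ.+ + (n + m))                 ≡⟨ cong (classSum N A j ℕ.+_) (classSum-periodic N B-m j) ⟩
    classSum N A j + classSum N B-m j                                 ≡⟨ +-comm (classSum N A j) (classSum N B-m j) ⟩
    classSum N B-m j + classSum N A j                                 ≡⟨ classSum-+ N B-m A j ⟨
    classSum N (λ i → B-m i + A i) j                                  ≡⟨ classSum-cong N d≡B+A j ⟨
    classSum N d j                                                    ∎
    where
    A-n = λ i → A (i ℤ.- + n)
    B-m = λ i → B (i ℤ.- + m)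
    full-period : (j ℤ.+ + n) ℤ.+ + m ≡ j ℤ.+ + (n + m)
    full-period = trans ([j+n]+m≡j+[n+m] j (+ n) (+ m)) (cong (λ x → j ℤ.+ x) (sym (ℤ.pos-+ n m)))

  classTotal : ℤ → ℕ
  classTotal j = sum (map d (filter (λ i → (n + m) ∣? ℤ.∣ i ℤ.- j ∣) (window N)))

  classTotal-constant : ∀ j → classTotal j ≡ classTotal (+ 0)
  classTotal-constant j = begin
    classTotal j         ≡⟨ classSum-sum-filter N d j ⟩
    classSum N d j       ≡⟨ coprime-periods⇒constant (classSum N d) n+m-coprime classSum-+n (classSum-periodic N d) j ⟩
    classSum N d (+ 0)   ≡⟨ classSum-sum-filter N d (+ 0) ⟨
    classTotal (+ 0)     ∎
    where
    n+m-coprime = coprime-sym (coprime-+ (coprime-sym coprime))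

  sum-window≡classTotal₀*period : sum (map d (window N)) ≡ classTotal (+ 0) * (n + m)
  sum-window≡classTotal₀*period = begin
    sum (map d (window N))                     ≡⟨ sum-by-residues {{coprime⇒+-nonZero coprime}} d (window N) ⟩
    sumBelow (n + m) (λ r → classTotal (+ r))  ≡⟨ sumBelow-cong (n + m) (λ r _ → classTotal-constant (+ r)) ⟩
    sumBelow (n + m) (λ _ → classTotal (+ 0))  ≡⟨ sumBelow-const (n + m) (classTotal (+ 0)) ⟩
    (n + m) * classTotal (+ 0)                 ≡⟨ *-comm (n + m) (classTotal (+ 0)) ⟩
    classTotal (+ 0) * (n + m)                 ∎
    where
    coprime⇒+-nonZero : ∀ {a b} → Coprime a b → NonZero (a + b)
    coprime⇒+-nonZero {ℕ.suc a}          _           = _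
    coprime⇒+-nonZero {ℕ.zero} {ℕ.suc b} _           = _
    coprime⇒+-nonZero {ℕ.zero} {ℕ.zero}  0-coprime-0 = contradiction (0-coprimeTo-m⇒m≡1 0-coprime-0) λ ()

module Roots {c ℓ} (K : CommutativeRing c ℓ) (isAlgClosed : IsAlgClosedField K) where

  open import Data.Nat using (zero; suc; NonZero)
  open import Data.List using (_∷_; replicate)
  open import Data.Product using (∃; _,_; proj₁; proj₂)
  open import Relation.Nullary using (¬_; yes; no; contradiction)
  open import Relation.Nullary.Decidable using (¬¬-excluded-middle)
  open CommutativeRing K renaming (Carrier to A) hiding (zero)
  open import Algebra.Properties.Ring ring using (+-inverseˡ-unique; -‿involutive)
  open import Relation.Binary.Reasoning.Setoid setoid
  open LinearAlgebra K (proj₁ isAlgClosed) using (inverse; 1≉0)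
  open Classical

  pow-cong : ∀ k {a b} → a ≈ b → pow K a k ≈ pow K b k
  pow-cong zero    a≈b = refl
  pow-cong (suc k) a≈b = *-cong a≈b (pow-cong k a≈b)

  pow-zero : ∀ k → .{{NonZero k}} → pow K 0# k ≈ 0#
  pow-zero (suc k) = zeroˡ _

  pow≈0⇒≈0 : ∀ k a → pow K a k ≈ 0# → ¬ ¬ a ≈ 0#
  pow≈0⇒≈0 zero    a 1≈0   = contradiction 1≈0 1≉0
  pow≈0⇒≈0 (suc k) a aaᵏ≈0 = ¬¬-excluded-middle >>= λ where
    (yes a≈0) → pure a≈0
    (no a≉0)  → let (b , ab≈1) = inverse a a≉0 in pow≈0⇒≈0 k a (begin
      pow K a k            ≈⟨ *-identityˡ _ ⟨
      1# * pow K a k       ≈⟨ *-congʳ (trans (*-comm b a) ab≈1) ⟨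
      b * a * pow K a k    ≈⟨ *-assoc _ _ _ ⟩
      b * (a * pow K a k)  ≈⟨ *-congˡ aaᵏ≈0 ⟩
      b * 0#               ≈⟨ zeroʳ _ ⟩
      0#                   ∎)

  evalMonic-Xᵏ : ∀ k x → evalMonic K (replicate k 0#) x ≈ pow K x k
  evalMonic-Xᵏ zero    x = refl
  evalMonic-Xᵏ (suc k) x = trans (+-identityˡ _) (*-congˡ (evalMonic-Xᵏ k x))

  ∃-root : ∀ k → .{{NonZero k}} → ∀ κ → ∃ λ μ → pow K μ k ≈ κ
  ∃-root (suc k) κ = μ , (begin
      μ * pow K μ k                               ≈⟨ *-congˡ (evalMonic-Xᵏ k μ) ⟨
      μ * evalMonic K (replicate k 0#) μ          ≈⟨ +-inverseˡ-unique _ _ (trans (+-comm _ _) (proj₂ root)) ⟩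
      - - κ                                       ≈⟨ -‿involutive κ ⟩
      κ                                           ∎)
    where
    root = proj₂ isAlgClosed (- κ) (replicate k 0#)
    μ = proj₁ root

module GradedPieces {c ℓ} (K : CommutativeRing c ℓ) (isField : IsField K)
                    (d : ℤ → ℕ) (N : ℕ) (d-supp : WindowSums.Supported N d) where

  open import Level using (_⊔_)
  open import Function using (_∘_)
  open import Data.Nat.Properties using (≰⇒>)
  import Data.Integer.Properties as ℤ
  open import Data.Fin using (Fin)
  open import Data.Fin.Properties using (¬Fin0)
  open import Data.Vec.Functional using (Vector)
  open import Data.List using (List; []; _∷_)
  open import Data.List.Membership.Propositional using (_∉_)
  open import Data.List.Relation.Unary.Any using (here; there)
  open import Data.Product using (∃; _,_; proj₁; proj₂)
  open import Relation.Nullary using (yes; no; contradiction)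
  open import Relation.Binary.PropositionalEquality as ≡ using (_≢_)
  open CommutativeRing K renaming (Carrier to A) hiding (zero)
  open import Algebra.Properties.Ring ring using (x+x≈x⇒x≈0)
  open import Relation.Binary.Reasoning.Setoid setoid
  open LinearAlgebra K isField using (_≋_; 0v)
  open WindowSums using (window; ∈-window)
  open import Algebra.Properties.AbelianGroup ℤ.+-0-abelianGroup using () renaming (∙-cancelʳ to ℤ-cancelʳ)

  private
    infix 4 _≈E_
    infixl 6 _+E_
    _≈E_ : Elem K d → Elem K d → Set ℓ
    _≈E_ = _≈ᴱ_ K d
    _+E_ : Elem K d → Elem K d → Elem K d
    _+E_ = _+ᴱ_ K d
    0E : Elem K d
    0E = 0ᴱ K d

  embed : ∀ i → Vector A (d i) → Elem K d
  embed i v j t with j ℤ.≟ i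
  ... | yes ≡.refl = v t
  ... | no _       = 0#

  embed-self : ∀ i v → embed i v i ≋ v
  embed-self i v t with i ℤ.≟ i
  ... | yes ≡.refl = refl
  ... | no i≢i     = contradiction ≡.refl i≢i

  embed-homog : ∀ i v → Homog K d i (embed i v)
  embed-homog i v j j≢i t with j ℤ.≟ i
  ... | yes j≡i = contradiction j≡i j≢i
  ... | no _    = refl

  embed-cong : ∀ i {v w} → v ≋ w → embed i v ≈E embed i w
  embed-cong i v≋w j t with j ℤ.≟ i
  ... | yes ≡.refl = v≋w t
  ... | no _       = refl

  embed-0 : ∀ i → embed i 0v ≈E 0E
  embed-0 i j t with j ℤ.≟ i
  ... | yes ≡.refl = refl
  ... | no _       = refl

  embed-+ : ∀ i v w → embed i (λ t → v t + w t) ≈E embed i v +E embed i w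
  embed-+ i v w j t with j ℤ.≟ i
  ... | yes ≡.refl = refl
  ... | no _       = sym (+-identityˡ 0#)

  embed-* : ∀ i μ v → embed i (λ t → μ * v t) ≈E _·ᴱ_ K d μ (embed i v)
  embed-* i μ v j t with j ℤ.≟ i
  ... | yes ≡.refl = refl
  ... | no _       = sym (zeroʳ μ)

  dropDegree : ℤ → Elem K d → Elem K d
  dropDegree i y j t with j ℤ.≟ i
  ... | yes _ = 0#
  ... | no _  = y j t

  embed+dropDegree : ∀ i y → y ≈E embed i (y i) +E dropDegree i y
  embed+dropDegree i y j t with j ℤ.≟ i
  ... | yes ≡.refl = sym (+-identityʳ _)
  ... | no _       = sym (+-identityˡ _)

  dropDegree-≈0 : ∀ i y j → (j ≢ i → ∀ t → y j t ≈ 0#) → ∀ t → dropDegree i y j t ≈ 0#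
  dropDegree-≈0 i y j y≈0 t with j ℤ.≟ i
  ... | yes _   = refl
  ... | no j≢i  = y≈0 j≢i t

  dim-outside-window : ∀ i → i ∉ window N → d i ≡ 0
  dim-outside-window i i∉window = d-supp i (≰⇒> (i∉window ∘ ∈-window i))

  outside-window : ∀ (y : Elem K d) i → i ∉ window N → ∀ t → y i t ≈ 0#
  outside-window y i i∉window t = contradiction (≡.subst Fin (dim-outside-window i i∉window) t) ¬Fin0

  record GradedMap (s : ℤ) : Set (c ⊔ ℓ) where
    field
      G        : Elem K d → Elem K d
      G-cong   : ∀ x y → x ≈E y → G x ≈E G y
      G-+      : ∀ x y → G (x +E y) ≈E G x +E G y
      G-graded : ∀ j x → Homog K d j x → Homog K d (j ℤ.+ s) (G x)

    G-0 : G 0E ≈E 0E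
    G-0 j t = x+x≈x⇒x≈0 (G 0E j t) (sym (trans (G-cong 0E (0E +E 0E) (λ _ _ → sym (+-identityˡ 0#)) j t) (G-+ 0E 0E j t)))

    component : ∀ i k → Vector A (d i) → Vector A (d k)
    component i k v = G (embed i v) k

    G-vanishes : ∀ (L : List ℤ) y j → (∀ i → i ∉ L → ∀ t → y i t ≈ 0#) → (∀ i → i ℤ.+ s ≡ j → ∀ t → y i t ≈ 0#) →
                 ∀ t → G y j t ≈ 0#
    G-vanishes []      y j y∉L≈0 y[j-s]≈0 t = trans (G-cong y 0E (λ i → y∉L≈0 i λ ()) j t) (G-0 j t)
    G-vanishes (i ∷ L) y j y∉L≈0 y[j-s]≈0 t = begin
      G y j t                                            ≈⟨ G-cong _ _ (embed+dropDegree i y) j t ⟩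
      G (embed i (y i) +E dropDegree i y) j t            ≈⟨ G-+ _ _ j t ⟩
      G (embed i (y i)) j t + G (dropDegree i y) j t     ≈⟨ +-cong piece-i rest ⟩
      0# + 0#                                            ≈⟨ +-identityˡ 0# ⟩
      0#                                                 ∎
      where
      piece-i : G (embed i (y i)) j t ≈ 0#
      piece-i with (i ℤ.+ s) ℤ.≟ j
      ... | yes i+s≡j = trans (G-cong _ 0E (λ k t → trans (embed-cong i (y[j-s]≈0 i i+s≡j) k t) (embed-0 i k t)) j t) (G-0 j t)
      ... | no i+s≢j  = G-graded i _ (embed-homog i (y i)) j (i+s≢j ∘ ≡.sym) t
      rest : G (dropDegree i y) j t ≈ 0#
      rest = G-vanishes L (dropDegree i y) j
        (λ k k∉L → dropDegree-≈0 i y k λ k≢i → y∉L≈0 k λ { (here k≡i) → k≢i k≡i ; (there k∈L) → k∉L k∈L })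
        (λ k k+s≡j → dropDegree-≈0 i y k λ _ → y[j-s]≈0 k k+s≡j)
        t

    G-local : ∀ y i j → i ℤ.+ s ≡ j → G y j ≋ component i j (y i)
    G-local y i j i+s≡j t = begin
      G y j t                                         ≈⟨ G-cong _ _ (embed+dropDegree i y) j t ⟩
      G (embed i (y i) +E dropDegree i y) j t         ≈⟨ G-+ _ _ j t ⟩
      component i j (y i) t + G (dropDegree i y) j t  ≈⟨ +-congˡ (G-vanishes (window N) (dropDegree i y) j (outside-window _) only-i t) ⟩
      component i j (y i) t + 0#                      ≈⟨ +-identityʳ _ ⟩
      component i j (y i) t                           ∎
      where
      only-i : ∀ k → k ℤ.+ s ≡ j → ∀ t → dropDegree i y k t ≈ 0#
      only-i k k+s≡j = dropDegree-≈0 i y k λ k≢i → contradiction (ℤ-cancelʳ s k i (≡.trans k+s≡j (≡.sym i+s≡j))) k≢i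

  homog-embed : ∀ j x → Homog K d j x → embed j (x j) ≈E x
  homog-embed j x x-homog i t with i ℤ.≟ j
  ... | yes ≡.refl = refl
  ... | no i≢j     = sym (x-homog i i≢j t)

  module ComponentExactness {s₁ s₂} (G₁ : GradedMap s₁) (G₂ : GradedMap s₂) where

    private
      module G₁ = GradedMap G₁
      module G₂ = GradedMap G₂

    component-im⊆ker : (∀ y → G₁.G (G₂.G y) ≈E 0E) → ∀ i j k → i ℤ.+ s₂ ≡ j →
                       ∀ v → G₁.component j k (G₂.component i j v) ≋ 0v
    component-im⊆ker G₁G₂≈0 i j k ≡.refl v t =
      trans (G₁.G-cong _ _ (homog-embed j _ (G₂.G-graded i _ (embed-homog i v))) k t) (G₁G₂≈0 (embed i v) k t)

    component-ker⊆im : (∀ x → G₁.G x ≈E 0E → ∃ λ y → G₂.G y ≈E x) → ∀ i j k → i ℤ.+ s₂ ≡ j → j ℤ.+ s₁ ≡ k →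
                       ∀ v → G₁.component j k v ≋ 0v → ∃ λ w → G₂.component i j w ≋ v
    component-ker⊆im ker⊆im i j k i+s₂≡j ≡.refl v G₁v≈0 = y i , λ t → begin
        G₂.component i j (y i) t   ≈⟨ G₂.G-local y i j i+s₂≡j t ⟨
        G₂.G y j t                 ≈⟨ G₂y≈ j t ⟩
        embed j v j t              ≈⟨ embed-self j v t ⟩
        v t                        ∎
      where
      G₁embed≈0 : G₁.G (embed j v) ≈E 0E
      G₁embed≈0 l t with l ℤ.≟ (j ℤ.+ s₁)
      ... | yes ≡.refl = G₁v≈0 t
      ... | no l≢k     = G₁.G-graded j _ (embed-homog j v) l l≢k t
      y = proj₁ (ker⊆im _ G₁embed≈0)
      G₂y≈ = proj₂ (ker⊆im _ G₁embed≈0)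

module DieudonneRanks {c ℓ} (K : CommutativeRing c ℓ) (isAlgClosed : IsAlgClosedField K)
                      {p n m} .{{_ : ℕ.NonZero p}} (Z : GradedDieudonne1 K p n m) where

  open import Function using (_∘_)
  open import Function.Bundles using (Equivalence)
  open import Data.Product using (Σ-syntax; _,_; proj₁; proj₂)
  open import Data.List.Membership.DecPropositional ℤ._≟_ using (_∈?_)
  open import Data.Integer.Tactic.RingSolver using (solve-∀)
  open import Relation.Nullary using (¬_; Dec; yes; no)
  open import Data.List.Membership.Propositional using (_∈_)
  open import Level using (_⊔_)
  open import Relation.Binary.PropositionalEquality as ≡ using ()
  open CommutativeRing K renaming (Carrier to A) hiding (zero)
  open GradedDieudonne1 Z
  open LinearAlgebra K (proj₁ isAlgClosed)
  open GradedPieces K (proj₁ isAlgClosed) d bound support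
  open WindowSums using (window)
  open Roots K isAlgClosed
  open Classical

  F-gradedMap : GradedMap (+ n)
  F-gradedMap = record { G = F ; G-cong = F-cong ; G-+ = F-add ; G-graded = F-graded }

  V-gradedMap : GradedMap (+ m)
  V-gradedMap = record { G = V ; G-cong = V-cong ; G-+ = V-add ; G-graded = V-graded }

  F-component : ∀ i k → SemilinearMap (d i) (d k)
  F-component i k = record
    { f                = GradedMap.component F-gradedMap i k
    ; f-cong           = λ v≋w t → F-cong _ _ (embed-cong i v≋w) k t
    ; f-+              = λ v w t → trans (F-cong _ _ (embed-+ i v w) k t) (F-add _ _ k t)
    ; Twist            = λ μ κ → κ ≈ pow K μ p
    ; f-twisted        = λ {μ} κ≈μᵖ v t → trans (F-cong _ _ (embed-* i μ v) k t) (trans (F-semi μ (embed i v) k t) (*-congʳ (sym κ≈μᵖ)))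
    ; twist-total      = λ μ → pow K μ p , refl
    ; twist-surjective = λ κ → proj₁ (∃-root p κ) , sym (proj₂ (∃-root p κ))
    ; twist-reflects-0 = λ {μ} κ≈μᵖ κ≈0 → pow≈0⇒≈0 p μ (trans (sym κ≈μᵖ) κ≈0)
    }

  V-component : ∀ i k → SemilinearMap (d i) (d k)
  V-component i k = record
    { f                = GradedMap.component V-gradedMap i k
    ; f-cong           = λ v≋w t → V-cong _ _ (embed-cong i v≋w) k t
    ; f-+              = λ v w t → trans (V-cong _ _ (embed-+ i v w) k t) (V-add _ _ k t)
    ; Twist            = λ μ κ → μ ≈ pow K κ p
    ; f-twisted        = λ {μ} {κ} μ≈κᵖ v t →
                           trans (V-cong _ _ (λ j t → trans (embed-* i μ v j t) (*-congʳ μ≈κᵖ)) k t) (V-semi κ (embed i v) k t)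
    ; twist-total      = λ μ → proj₁ (∃-root p μ) , sym (proj₂ (∃-root p μ))
    ; twist-surjective = λ κ → pow K κ p , refl
    ; twist-reflects-0 = λ μ≈κᵖ κ≈0 → pure (trans μ≈κᵖ (trans (pow-cong p κ≈0) (pow-zero p)))
    }

  record RanksAt (i : ℤ) : Set (c ⊔ ℓ) where
    field
      rankF    : ℕ
      hasRankF : HasRank (F-component i (i ℤ.+ + n)) rankF
      rankV    : ℕ
      hasRankV : HasRank (V-component i (i ℤ.+ + m)) rankV
  open RanksAt

  ranks-everywhere : ¬ ¬ (∀ i → RanksAt i)
  ranks-everywhere = do
      inside ← ¬¬-∀∈ ranks-at (window bound)
      pure λ i → choose i (i ∈? window bound) inside
    where
    ranks-at : ∀ i → ¬ ¬ RanksAt i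
    ranks-at i = do
      (a , hasRank-a) ← rank-exists (F-component i (i ℤ.+ + n))
      (b , hasRank-b) ← rank-exists (V-component i (i ℤ.+ + m))
      pure record { rankF = a ; hasRankF = hasRank-a ; rankV = b ; hasRankV = hasRank-b }
    choose : ∀ i → Dec (i ∈ window bound) → (∀ i → i ∈ window bound → RanksAt i) → RanksAt i
    choose i (yes i∈) inside = inside i i∈
    choose i (no i∉)  _      = record
      { rankF = 0 ; hasRankF = rank-of-trivial-domain (dim-outside-window i i∉) (F-component i (i ℤ.+ + n))
      ; rankV = 0 ; hasRankV = rank-of-trivial-domain (dim-outside-window i i∉) (V-component i (i ℤ.+ + m))
      }

  private
    [j-s]+s≡j : ∀ (j s : ℤ) → (j ℤ.- s) ℤ.+ s ≡ j
    [j-s]+s≡j = solve-∀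

  module _ (ranks : ∀ i → RanksAt i) (j : ℤ) where

    private
      module FV = ComponentExactness F-gradedMap V-gradedMap
      module VF = ComponentExactness V-gradedMap F-gradedMap
      j-m+m≡j = [j-s]+s≡j j (+ m)
      j-n+n≡j = [j-s]+s≡j j (+ n)

    dim≡rankV+rankF : d j ≡ rankV (ranks (j ℤ.- + m)) ℕ.+ rankF (ranks j)
    dim≡rankV+rankF = exact⇒dim≡rank+rank (F-component j (j ℤ.+ + n)) (V-component (j ℤ.- + m) j)
      (FV.component-ker⊆im (λ x → Equivalence.to (kerF=imV x)) (j ℤ.- + m) j (j ℤ.+ + n) j-m+m≡j ≡.refl)
      (FV.component-im⊆ker (λ y → Equivalence.from (kerF=imV (V y)) (y , λ _ _ → refl)) (j ℤ.- + m) j (j ℤ.+ + n) j-m+m≡j)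
      (hasRankF (ranks j))
      (≡.subst (λ k → HasRank (V-component (j ℤ.- + m) k) (rankV (ranks (j ℤ.- + m)))) j-m+m≡j (hasRankV (ranks (j ℤ.- + m))))

    dim≡rankF+rankV : d j ≡ rankF (ranks (j ℤ.- + n)) ℕ.+ rankV (ranks j)
    dim≡rankF+rankV = exact⇒dim≡rank+rank (V-component j (j ℤ.+ + m)) (F-component (j ℤ.- + n) j)
      (VF.component-ker⊆im (λ x → Equivalence.from (imF=kerV x)) (j ℤ.- + n) j (j ℤ.+ + m) j-n+n≡j ≡.refl)
      (VF.component-im⊆ker (λ y → Equivalence.to (imF=kerV (F y)) (y , λ _ _ → refl)) (j ℤ.- + n) j (j ℤ.+ + m) j-n+n≡j)
      (hasRankV (ranks j))
      (≡.subst (λ k → HasRank (F-component (j ℤ.- + n) k) (rankF (ranks (j ℤ.- + n)))) j-n+n≡j (hasRankF (ranks (j ℤ.- + n))))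

  dimension-equations : ¬ ¬ (Σ[ A ∈ (ℤ → ℕ) ] Σ[ B ∈ (ℤ → ℕ) ]
                               (∀ j → d j ≡ B (j ℤ.- + m) ℕ.+ A j) × (∀ j → d j ≡ A (j ℤ.- + n) ℕ.+ B j))
  dimension-equations = do
    ranks ← ranks-everywhere
    pure (rankF ∘ ranks , rankV ∘ ranks , dim≡rankV+rankF ranks , dim≡rankF+rankV ranks)

lemma3p3 : ∀ {a ℓ} (K : CommutativeRing a ℓ) (p : ℕ) →
    IsAlgClosedField K → HasCharacteristic K p →
    (n m : ℕ) → Coprime n m → (Z : GradedDieudonne1 K p n m) →
    ∃[ c ] ((+ GradedDieudonne1.dim Z ≡ c ℤ.* + (n ℕ.+ m))
    × (∀ (j : ℤ) → + GradedDieudonne1.classDim Z (n ℕ.+ m) j ≡ c))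
lemma3p3 K p isAlgClosed (p-prime , _) n m coprime Z =
  + C₀ , ≡.trans (≡.cong +_ dim≡C₀*q) (pos-* C₀ (n ℕ.+ m)) , λ j → ≡.cong +_ (classDim≡C₀ j)
  where
  open GradedDieudonne1 Z
  open Classical using (_>>=_; pure)
  instance _ = prime⇒nonZero p-prime
  open DieudonneRanks K isAlgClosed Z using (dimension-equations)
  C₀ = classDim (n ℕ.+ m) (+ 0)
  dim≡C₀*q : dim ≡ C₀ ℕ.* (n ℕ.+ m)
  dim≡C₀*q = decidable-stable (dim ℕ.≟ C₀ ℕ.* (n ℕ.+ m)) do
    (A , B , d≡B+A , d≡A+B) ← dimension-equations
    pure (Counting.sum-window≡classTotal₀*period coprime {A = A} {B} support d≡B+A d≡A+B)
  classDim≡C₀ : ∀ j → classDim (n ℕ.+ m) j ≡ C₀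
  classDim≡C₀ j = decidable-stable (classDim (n ℕ.+ m) j ℕ.≟ C₀) do
    (A , B , d≡B+A , d≡A+B) ← dimension-equations
    pure (Counting.classTotal-constant coprime {A = A} {B} support d≡B+A d≡A+B j)
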